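{- There is a recursive permutation $g$ of $\mathbb{N}$ whose cycle relation $\equiv_g$ is decidable but whose cycle finiteness problem $\{x : |[x]_g| < \infty\}$ is undecidable; i.e. $g \in \operatorname{Perm}\setminus\operatorname{Perm}_{\mathrm{CF}}$.
   Context: $[x]_g = \{g^k(x):k\in\mathbb{Z}\}$; $x\equiv_g x'$ means $x'\in[x]_g$. $\operatorname{Perm}$ is the set of recursive permutations with decidable cycle relation and $\operatorname{Perm}_{\mathrm{CF}}$ its subset of those whose cycle finiteness problem is decidable. -}

module Defs where

open import Data.Nat using (ℕ; zero; suc; _<_)
open import Data.Fin using (Fin)
open import Data.Vec using (Vec; []; _∷_; lookup)
open import Data.Integer using (ℤ; +_; -[1+_])
open import Data.List using (List)
open import Data.List.Membership.Propositional using (_∈_)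
open import Data.Product using (Σ; ∃; _×_)
open import Data.Sum using (_⊎_)
open import Relation.Nullary using (¬_)
open import Relation.Binary.PropositionalEquality using (_≡_)
open import Function using (_↔_; Inverse)
open import Function.Base using (id; _∘_)

data Code : ℕ → Set where
  zer  : ∀ {n} → Code n
  succ : Code 1
  proj : ∀ {n} → Fin n → Code n
  comp : ∀ {m n} → Code m → Vec (Code n) m → Code n
  prec : ∀ {n} → Code n → Code (suc (suc n)) → Code (suc n)
  mu   : ∀ {n} → Code (suc n) → Code n

mutual
  data Eval : ∀ {n} → Code n → Vec ℕ n → ℕ → Set where
    e-zer  : ∀ {n} {xs : Vec ℕ n} → Eval zer xs 0
    e-succ : ∀ {x} → Eval succ (x ∷ []) (suc x)
    e-proj : ∀ {n} {i : Fin n} {xs} → Eval (proj i) xs (lookup xs i)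
    e-comp : ∀ {m n} {f : Code m} {gs : Vec (Code n) m} {xs ys v} →
             EvalAll gs xs ys → Eval f ys v → Eval (comp f gs) xs v
    e-prec-z : ∀ {n} {f : Code n} {g xs v} →
               Eval f xs v → Eval (prec f g) (0 ∷ xs) v
    e-prec-s : ∀ {n} {f : Code n} {g xs y r v} →
               Eval (prec f g) (y ∷ xs) r → Eval g (y ∷ r ∷ xs) v →
               Eval (prec f g) (suc y ∷ xs) v
    e-mu   : ∀ {n} {f : Code (suc n)} {xs y} →
             Eval f (y ∷ xs) 0 →
             (∀ z → z < y → ∃ λ w → Eval f (z ∷ xs) (suc w)) →
             Eval (mu f) xs y

  data EvalAll : ∀ {m n} → Vec (Code n) m → Vec ℕ n → Vec ℕ m → Set where
    []  : ∀ {n} {xs : Vec ℕ n} → EvalAll [] xs []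
    _∷_ : ∀ {m n} {g : Code n} {gs : Vec (Code n) m} {xs y ys} →
          Eval g xs y → EvalAll gs xs ys → EvalAll (g ∷ gs) xs (y ∷ ys)

Recursive : (ℕ → ℕ) → Set
Recursive f = Σ (Code 1) λ c → ∀ x → Eval c (x ∷ []) (f x)

RecDecidable : (ℕ → Set) → Set
RecDecidable P = Σ (Code 1) λ c → ∀ x →
  (P x × Eval c (x ∷ []) 1) ⊎ (¬ P x × Eval c (x ∷ []) 0)

RecDecidable₂ : (ℕ → ℕ → Set) → Set
RecDecidable₂ R = Σ (Code 2) λ c → ∀ x y →
  (R x y × Eval c (x ∷ y ∷ []) 1) ⊎ (¬ R x y × Eval c (x ∷ y ∷ []) 0)

Perm : Set
Perm = ℕ ↔ ℕ

iter : (ℕ → ℕ) → ℕ → ℕ → ℕ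
iter f zero    = id
iter f (suc n) = f ∘ iter f n

pow : Perm → ℤ → ℕ → ℕ
pow g (+ n)      = iter (Inverse.to g) n
pow g -[1+ n ]   = iter (Inverse.from g) (suc n)

CycleRel : Perm → ℕ → ℕ → Set
CycleRel g x x' = ∃ λ (k : ℤ) → pow g k x ≡ x'

CycleFinite : Perm → ℕ → Set
CycleFinite g x = ∃ λ (l : List ℕ) → ∀ (k : ℤ) → pow g k x ∈ l

-- Each column {⟨ e , n ⟩ : n ∈ ℕ} is permuted separately. Its points form the two-sided chain
-- ⋯ → 3 → 1 → 0 → 2 → 4 → ⋯, which is closed into the cycle 0 → 2 → ⋯ → 2s − 2 → 2s − 1 → ⋯ → 1 → 0
-- at the first stage s by which a certificate shows that the code numbered e halts on input e;
-- the points beyond the cut are fixed. Since certificates of μ-recursive evaluations can be checked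
-- by a primitive recursive function, the permutation is recursive, and two points lie on a common
-- cycle iff they share a column and either coincide or both lie before the cut, which is decidable.
-- The cycle of ⟨ e , 0 ⟩, however, is finite iff e halts on itself, and a decider for that would
-- diagonalise against itself.

module Submission where

open import Defs
open import Data.Bool using (Bool; true; false; T; not; if_then_else_; _∧_; _∨_)
open import Data.Bool.Properties using (if-float; T-≡; T-∧; T-∨; T-not-≡; T?)
open import Data.Fin using (Fin; zero; suc; #_) renaming (toℕ to finToℕ)
open import Data.Integer using (+_; -[1+_])
open import Data.List using (List; []; _∷_; _++_; map; upTo)
open import Data.List.Extrema.Nat using (max; xs≤max)
open import Data.List.Membership.Propositional using (_∈_; find; lose)
open import Data.List.Membership.Propositional.Properties using (∈-map⁺; ∈-upTo⁺)
open import Data.List.Relation.Binary.Subset.Propositional using (_⊆_)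
open import Data.List.Relation.Binary.Subset.Propositional.Properties using (Any-resp-⊆; xs⊆xs++ys; xs⊆ys++xs)
import Data.List.Relation.Unary.All as All
open import Data.List.Relation.Unary.Any using (Any; here; there)
import Data.List.Relation.Unary.Any as Any
open import Data.Nat using (ℕ; zero; suc; _+_; _∸_; _≤_; _<_; _≡ᵇ_; pred; z≤n; s≤s)
open import Data.Nat.Induction using (<-rec)
open import Data.Nat.Properties
  using ( +-comm; +-monoʳ-≤; 0∸n≡0; 0≢1+n; <-cmp; <-≤-trans; <⇒≤; <⇒≱; m+[n∸m]≡n; m+n∸m≡n
        ; m<n⇒m<1+n; m∸n+n≡m; m≤m+n; m≤n+m; m≤n⇒m<n∨m≡n; m≤n⇒m≤1+n; n<1+n; n≤1+n; pred[m∸n]≡m∸[1+n]; ∸-monoˡ-≤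
        ; ≡ᵇ⇒≡; ≡⇒≡ᵇ; ≤-pred; ≤-refl; ≤-reflexive; ≤-total; ≤-trans; ≰⇒>; module ≤-Reasoning )
open import Data.Product using (Σ; ∃; _×_; _,_; proj₁; proj₂)
import Data.Product as Product
open import Data.Sum using (_⊎_; inj₁; inj₂; swap)
import Data.Sum as Sum
open import Data.Vec using (Vec; []; _∷_; lookup; head; tail; tabulate) renaming (_++_ to _++ᵛ_)
open import Data.Vec.Properties using (tabulate∘lookup)
open import Function.Base using (id; _∘_; const; case_of_)
open import Function.Bundles using (Inverse; Equivalence; _⇔_; mk⇔; mk↔ₛ′)
open import Relation.Binary.Definitions using (tri<; tri≈; tri>)
open import Relation.Binary.PropositionalEquality
open import Relation.Nullary using (¬_; contradiction)
open import Relation.Nullary.Decidable using (decidable-stable)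

open Equivalence using (to; from)

variable
  m n : ℕ

natrec : {A : Set} → A → (ℕ → A → A) → ℕ → A
natrec z s zero    = z
natrec z s (suc k) = s k (natrec z s k)

iter-+ : ∀ (f : ℕ → ℕ) a b x → iter f (a + b) x ≡ iter f a (iter f b x)
iter-+ f zero    b x = refl
iter-+ f (suc a) b x = cong f (iter-+ f a b x)

iter-suc : ∀ (f : ℕ → ℕ) a x → iter f (suc a) x ≡ iter f a (f x)
iter-suc f zero    x = refl
iter-suc f (suc a) x = cong f (iter-suc f a x)

ComputableV : ∀ n → (Vec ℕ n → ℕ) → Set
ComputableV n F = Σ (Code n) λ c → ∀ xs → Eval c xs (F xs)

data ComputablesV (n : ℕ) : ∀ {m} → (Vec ℕ n → Vec ℕ m) → Set where
  []  : ComputablesV n (λ _ → [])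
  _∷_ : ∀ {m F} {Fs : Vec ℕ n → Vec ℕ m} →
        ComputableV n F → ComputablesV n Fs → ComputablesV n (λ xs → F xs ∷ Fs xs)

NatFun : ℕ → Set
NatFun zero    = ℕ
NatFun (suc n) = ℕ → NatFun n

uncurryᵛ : NatFun n → Vec ℕ n → ℕ
uncurryᵛ f []       = f
uncurryᵛ f (x ∷ xs) = uncurryᵛ (f x) xs

curryᵛ : (Vec ℕ n → ℕ) → NatFun n
curryᵛ {zero}  F = F []
curryᵛ {suc n} F = λ x → curryᵛ (λ xs → F (x ∷ xs))

uncurryᵛ-curryᵛ : (F : Vec ℕ n → ℕ) (xs : Vec ℕ n) → uncurryᵛ (curryᵛ F) xs ≡ F xs
uncurryᵛ-curryᵛ F []       = refl
uncurryᵛ-curryᵛ F (x ∷ xs) = uncurryᵛ-curryᵛ (λ ys → F (x ∷ ys)) xs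

record Computable (n : ℕ) (f : NatFun n) : Set where
  constructor computable
  field
    code : Code n
    eval : ∀ xs → Eval code xs (uncurryᵛ f xs)

open Computable public

ComputableV-ext : {F G : Vec ℕ n → ℕ} → F ≗ G → ComputableV n F → ComputableV n G
ComputableV-ext F≗G (c , ev) = c , λ xs → subst (Eval c xs) (F≗G xs) (ev xs)

fromV-≗ : {F : Vec ℕ n → ℕ} {f : NatFun n} → F ≗ uncurryᵛ f → ComputableV n F → Computable n f
fromV-≗ F≗f cF = let (c , ev) = ComputableV-ext F≗f cF in computable c ev

fromV : {F : Vec ℕ n → ℕ} → ComputableV n F → Computable n (curryᵛ F)
fromV {F = F} = fromV-≗ (λ xs → sym (uncurryᵛ-curryᵛ F xs))

toV : {f : NatFun n} → Computable n f → ComputableV n (uncurryᵛ f)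
toV cf = code cf , eval cf

codesOf : {Fs : Vec ℕ n → Vec ℕ m} → ComputablesV n Fs → Vec (Code n) m
codesOf []       = []
codesOf (cF ∷ cFs) = proj₁ cF ∷ codesOf cFs

evalAllOf : {Fs : Vec ℕ n → Vec ℕ m} (cFs : ComputablesV n Fs) → ∀ xs → EvalAll (codesOf cFs) xs (Fs xs)
evalAllOf []         xs = []
evalAllOf (cF ∷ cFs) xs = proj₂ cF xs ∷ evalAllOf cFs xs

composeᶜ : {F : Vec ℕ m → ℕ} {Fs : Vec ℕ n → Vec ℕ m} → ComputableV m F → ComputablesV n Fs →
           ComputableV n (λ xs → F (Fs xs))
composeᶜ (c , ev) cFs = comp c (codesOf cFs) , λ xs → e-comp (evalAllOf cFs xs) (ev _)

infixl 4 _$ᶜ_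

_$ᶜ_ : {f : NatFun m} {Fs : Vec ℕ n → Vec ℕ m} → Computable m f → ComputablesV n Fs →
       ComputableV n (λ xs → uncurryᵛ f (Fs xs))
cf $ᶜ cFs = composeᶜ (toV cf) cFs

projᶜ : (i : Fin n) → ComputableV n (λ xs → lookup xs i)
projᶜ i = proj i , λ _ → e-proj

selectᶜ : (σ : Fin m → Fin n) → ComputablesV n (λ xs → tabulate (λ i → lookup xs (σ i)))
selectᶜ {zero}  σ = []
selectᶜ {suc m} σ = projᶜ (σ zero) ∷ selectᶜ (σ ∘ suc)

infixr 5 _++ᶜ_

_++ᶜ_ : {Fs : Vec ℕ n → Vec ℕ m} {k : ℕ} {Gs : Vec ℕ n → Vec ℕ k} → ComputablesV n Fs → ComputablesV n Gs →
        ComputablesV n (λ xs → Fs xs ++ᵛ Gs xs)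
[]         ++ᶜ cGs = cGs
(cF ∷ cFs) ++ᶜ cGs = cF ∷ (cFs ++ᶜ cGs)

letᶜ : {F : Vec ℕ (suc n) → ℕ} {G : Vec ℕ n → ℕ} → ComputableV (suc n) F → ComputableV n G →
       ComputableV n (λ xs → F (G xs ∷ xs))
letᶜ {F = F} cF cG = ComputableV-ext (λ xs → cong (λ ys → F (_ ∷ ys)) (tabulate∘lookup xs))
  (composeᶜ cF (cG ∷ selectᶜ id))

prependᶜ : {F : Vec ℕ (m + n) → ℕ} {Gs : Vec ℕ (suc n) → Vec ℕ m} → ComputableV (m + n) F → ComputablesV (suc n) Gs →
           ComputableV (suc n) (λ ys → F (Gs ys ++ᵛ tail ys))
prependᶜ {F = F} {Gs} cF cGs = ComputableV-ext (λ { ys@(_ ∷ xs) → cong (λ zs → F (Gs ys ++ᵛ zs)) (tabulate∘lookup xs) })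
  (composeᶜ cF (cGs ++ᶜ selectᶜ (λ i → suc i)))

skip₁ᶜ : {F : Vec ℕ (suc n) → ℕ} → ComputableV (suc n) F → ComputableV (2 + n) (λ ys → F (head ys ∷ tail (tail ys)))
skip₁ᶜ {F = F} cF = ComputableV-ext (λ { (x ∷ _ ∷ xs) → cong (λ ys → F (x ∷ ys)) (tabulate∘lookup xs) })
  (composeᶜ cF (projᶜ zero ∷ selectᶜ (λ i → suc (suc i))))

-- xᵢ is the i-th argument; the combinators binding a variable (natrecᶜ, any<ᶜ, all<ᶜ, anyOutputᶜ)
-- put it in front, shifting the other arguments.
x₀ : ComputableV (suc n) (λ xs → lookup xs (# 0))
x₀ = projᶜ (# 0)

x₁ : ComputableV (2 + n) (λ xs → lookup xs (# 1))
x₁ = projᶜ (# 1)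

x₂ : ComputableV (3 + n) (λ xs → lookup xs (# 2))
x₂ = projᶜ (# 2)

x₃ : ComputableV (4 + n) (λ xs → lookup xs (# 3))
x₃ = projᶜ (# 3)

x₄ : ComputableV (5 + n) (λ xs → lookup xs (# 4))
x₄ = projᶜ (# 4)

x₅ : ComputableV (6 + n) (λ xs → lookup xs (# 5))
x₅ = projᶜ (# 5)

x₆ : ComputableV (7 + n) (λ xs → lookup xs (# 6))
x₆ = projᶜ (# 6)

x₇ : ComputableV (8 + n) (λ xs → lookup xs (# 7))
x₇ = projᶜ (# 7)

sucᶜ : {F : Vec ℕ n → ℕ} → ComputableV n F → ComputableV n (λ xs → suc (F xs))
sucᶜ cF = computable succ (λ { (x ∷ []) → e-succ }) $ᶜ cF ∷ []

constᶜ : ∀ k → ComputableV n (λ _ → k)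
constᶜ zero    = zer , λ _ → e-zer
constᶜ (suc k) = sucᶜ (constᶜ k)

natrecᶜ : {Z : Vec ℕ n → ℕ} {S : Vec ℕ (2 + n) → ℕ} → ComputableV n Z → ComputableV (2 + n) S →
          ComputableV (suc n) (λ xs → natrec (Z (tail xs)) (λ k r → S (k ∷ r ∷ tail xs)) (head xs))
natrecᶜ {Z = Z} {S} (cZ , evZ) (cS , evS) = prec cZ cS , λ { (k ∷ xs) → eval-natrec k xs }
  where
  eval-natrec : ∀ k xs → Eval (prec cZ cS) (k ∷ xs) (natrec (Z xs) (λ k r → S (k ∷ r ∷ xs)) k)
  eval-natrec zero    xs = e-prec-z (evZ xs)
  eval-natrec (suc k) xs = e-prec-s (eval-natrec k xs) (evS (k ∷ _ ∷ xs))

+-computable : Computable 2 _+_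
+-computable = fromV-≗ (λ { (a ∷ b ∷ []) → natrec-+ a b })
  (natrecᶜ x₀ (sucᶜ x₁))
  where
  natrec-+ : ∀ a b → natrec b (λ _ r → suc r) a ≡ a + b
  natrec-+ zero    b = refl
  natrec-+ (suc a) b = cong suc (natrec-+ a b)

pred-computable : Computable 1 pred
pred-computable = fromV-≗ (λ { (zero ∷ []) → refl ; (suc a ∷ []) → refl })
  (natrecᶜ (constᶜ 0) x₀)

∸-computable : Computable 2 _∸_
∸-computable = fromV-≗ (λ { (a ∷ b ∷ []) → natrec-∸ b a })
  (fromV (natrecᶜ x₀ (pred-computable $ᶜ x₁ ∷ [])) $ᶜ x₁ ∷ x₀ ∷ [])
  where
  natrec-∸ : ∀ a b → natrec b (λ _ r → pred r) a ≡ b ∸ a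
  natrec-∸ zero    b = refl
  natrec-∸ (suc a) b = trans (cong pred (natrec-∸ a b)) (pred[m∸n]≡m∸[1+n] b a)

fromBool : Bool → ℕ
fromBool true  = 1
fromBool false = 0

DecidableV : ∀ n → (Vec ℕ n → Bool) → Set
DecidableV n P = ComputableV n (λ xs → fromBool (P xs))

DecidableV-ext : {P Q : Vec ℕ n → Bool} → P ≗ Q → DecidableV n P → DecidableV n Q
DecidableV-ext P≗Q = ComputableV-ext (λ xs → cong fromBool (P≗Q xs))

ifᶜ : {B : Vec ℕ n → Bool} {F G : Vec ℕ n → ℕ} → DecidableV n B → ComputableV n F → ComputableV n G →
      ComputableV n (λ xs → if B xs then F xs else G xs)
ifᶜ {B = B} cB cF cG = ComputableV-ext (λ xs → natrec-if (B xs))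
  (fromV (natrecᶜ x₀ x₃) $ᶜ cB ∷ cG ∷ cF ∷ [])
  where
  natrec-if : ∀ b {x y} → natrec y (λ _ _ → x) (fromBool b) ≡ (if b then x else y)
  natrec-if true  = refl
  natrec-if false = refl

ifᵇᶜ : {B P Q : Vec ℕ n → Bool} → DecidableV n B → DecidableV n P → DecidableV n Q →
       DecidableV n (λ xs → if B xs then P xs else Q xs)
ifᵇᶜ {B = B} cB cP cQ = ComputableV-ext (λ xs → sym (if-float fromBool (B xs))) (ifᶜ cB cP cQ)

trueᶜ : DecidableV n (λ _ → true)
trueᶜ = constᶜ 1

falseᶜ : DecidableV n (λ _ → false)
falseᶜ = constᶜ 0

∧ᶜ : {P Q : Vec ℕ n → Bool} → DecidableV n P → DecidableV n Q → DecidableV n (λ xs → P xs ∧ Q xs)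
∧ᶜ {P = P} cP cQ = DecidableV-ext (λ xs → if-∧ (P xs)) (ifᵇᶜ cP cQ falseᶜ)
  where
  if-∧ : ∀ a {b} → (if a then b else false) ≡ a ∧ b
  if-∧ true  = refl
  if-∧ false = refl

∨ᶜ : {P Q : Vec ℕ n → Bool} → DecidableV n P → DecidableV n Q → DecidableV n (λ xs → P xs ∨ Q xs)
∨ᶜ {P = P} cP cQ = DecidableV-ext (λ xs → if-∨ (P xs)) (ifᵇᶜ cP trueᶜ cQ)
  where
  if-∨ : ∀ a {b} → (if a then true else b) ≡ a ∨ b
  if-∨ true  = refl
  if-∨ false = refl

notᶜ : {P : Vec ℕ n → Bool} → DecidableV n P → DecidableV n (λ xs → not (P xs))
notᶜ {P = P} cP = DecidableV-ext (λ xs → if-not (P xs)) (ifᵇᶜ cP falseᶜ trueᶜ)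
  where
  if-not : ∀ a → (if a then false else true) ≡ not a
  if-not true  = refl
  if-not false = refl

≡ᵇ-computable : Computable 2 (λ a b → fromBool (a ≡ᵇ b))
≡ᵇ-computable = fromV-≗ (λ { (a ∷ b ∷ []) → ≡ᵇ-via-∸ a b })
  (∸-computable $ᶜ constᶜ 1 ∷ (+-computable $ᶜ (∸-computable $ᶜ x₀ ∷ x₁ ∷ []) ∷ (∸-computable $ᶜ x₁ ∷ x₀ ∷ []) ∷ []) ∷ [])
  where
  ≡ᵇ-via-∸ : ∀ a b → 1 ∸ ((a ∸ b) + (b ∸ a)) ≡ fromBool (a ≡ᵇ b)
  ≡ᵇ-via-∸ zero    zero    = refl
  ≡ᵇ-via-∸ zero    (suc b) = 0∸n≡0 b
  ≡ᵇ-via-∸ (suc a) zero    = 0∸n≡0 (a + 0)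
  ≡ᵇ-via-∸ (suc a) (suc b) = ≡ᵇ-via-∸ a b

≡ᵇᶜ : {F G : Vec ℕ n → ℕ} → ComputableV n F → ComputableV n G → DecidableV n (λ xs → F xs ≡ᵇ G xs)
≡ᵇᶜ cF cG = ≡ᵇ-computable $ᶜ cF ∷ cG ∷ []

Computable⇒Recursive : {f : ℕ → ℕ} → Computable 1 f → Recursive f
Computable⇒Recursive cf = code cf , λ x → eval cf (x ∷ [])

RecDecidable₂-reflects : {r : ℕ → ℕ → Bool} {R : ℕ → ℕ → Set} →
                         Computable 2 (λ x y → fromBool (r x y)) → (∀ x y → T (r x y) ⇔ R x y) → RecDecidable₂ R
RecDecidable₂-reflects {r} {R} cr r⇔R = code cr , λ x y → decide x y (eval cr (x ∷ y ∷ []))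
  where
  decide : ∀ x y → Eval (code cr) (x ∷ y ∷ []) (fromBool (r x y)) →
           (R x y × Eval (code cr) (x ∷ y ∷ []) 1) ⊎ (¬ R x y × Eval (code cr) (x ∷ y ∷ []) 0)
  decide x y with r x y in eq
  ... | true  = λ ev → inj₁ (r⇔R x y .to (subst T (sym eq) _) , ev)
  ... | false = λ ev → inj₂ ((λ rxy → subst T eq (r⇔R x y .from rxy)) , ev)

RecDecidable-⇔ : {P Q : ℕ → Set} → (∀ x → P x ⇔ Q x) → RecDecidable P → RecDecidable Q
RecDecidable-⇔ P⇔Q (c , decides) = c , λ x →
  Sum.map (Product.map₁ (P⇔Q x .to)) (Product.map₁ (_∘ P⇔Q x .from)) (decides x)

RecDecidable-∘ : {P : ℕ → Set} {f : ℕ → ℕ} → Computable 1 f → RecDecidable P → RecDecidable (P ∘ f)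
RecDecidable-∘ {f = f} cf (c , decides) = comp c (code cf ∷ []) , λ x →
  Sum.map (Product.map₂ (e-comp (eval cf (x ∷ []) ∷ []))) (Product.map₂ (e-comp (eval cf (x ∷ []) ∷ []))) (decides (f x))

iter-computable : {f : ℕ → ℕ} → Computable 1 f → Computable 2 (iter f)
iter-computable {f} cf = fromV-≗ (λ { (k ∷ x ∷ []) → natrec-iter k x }) (natrecᶜ x₀ (cf $ᶜ x₁ ∷ []))
  where
  natrec-iter : ∀ k x → natrec x (λ _ r → f r) k ≡ iter f k x
  natrec-iter zero    x = refl
  natrec-iter (suc k) x = cong f (natrec-iter k x)

T-not : ∀ {b} → T (not b) ⇔ (¬ T b)
T-not {true}  = mk⇔ (λ ()) (λ ¬⊤ → ¬⊤ _)
T-not {false} = mk⇔ (λ _ ()) (λ _ → _)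

∧-monoᵀ : ∀ {a a′ b b′} → (T a → T a′) → (T b → T b′) → T (a ∧ b) → T (a′ ∧ b′)
∧-monoᵀ f g ab = let (a , b) = T-∧ .to ab in T-∧ .from (f a , g b)

-- The searches are opaque: they are used only through the lemmas proved with them, and unfolding
-- them in goals defeats unification.
opaque

  any< : ℕ → (ℕ → Bool) → Bool
  any< m p = natrec false (λ k r → p k ∨ r) m

  all< : ℕ → (ℕ → Bool) → Bool
  all< m p = natrec true (λ k r → p k ∧ r) m

  any<ᶜ : {Q : Vec ℕ (suc n) → Bool} {M : Vec ℕ n → ℕ} → DecidableV (suc n) Q → ComputableV n M →
          DecidableV n (λ xs → any< (M xs) (λ k → Q (k ∷ xs)))
  any<ᶜ {Q = Q} {M} cQ cM = ComputableV-ext (λ xs → natrec-any< (λ k → Q (k ∷ xs)) (M xs))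
    (letᶜ (natrecᶜ falseᶜ (ifᶜ (skip₁ᶜ cQ) trueᶜ x₁)) cM)
    where
    natrec-any< : ∀ p m → natrec 0 (λ k r → if p k then 1 else r) m ≡ fromBool (any< m p)
    natrec-any< p zero = refl
    natrec-any< p (suc m) with p m
    ... | true  = refl
    ... | false = natrec-any< p m

  all<ᶜ : {Q : Vec ℕ (suc n) → Bool} {M : Vec ℕ n → ℕ} → DecidableV (suc n) Q → ComputableV n M →
          DecidableV n (λ xs → all< (M xs) (λ k → Q (k ∷ xs)))
  all<ᶜ {Q = Q} {M} cQ cM = ComputableV-ext (λ xs → natrec-all< (λ k → Q (k ∷ xs)) (M xs))
    (letᶜ (natrecᶜ trueᶜ (ifᶜ (skip₁ᶜ cQ) x₁ falseᶜ)) cM)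
    where
    natrec-all< : ∀ p m → natrec 1 (λ k r → if p k then r else 0) m ≡ fromBool (all< m p)
    natrec-all< p zero = refl
    natrec-all< p (suc m) with p m
    ... | true  = natrec-all< p m
    ... | false = refl

  any<⁺ : ∀ {m k} (p : ℕ → Bool) → k < m → T (p k) → T (any< m p)
  any<⁺ {suc m} {k} p k<1+m pk with m≤n⇒m<n∨m≡n k<1+m
  ... | inj₁ k<m = T-∨ .from (inj₂ (any<⁺ p (≤-pred k<m) pk))
  ... | inj₂ refl = T-∨ .from (inj₁ pk)

  any<⁻ : ∀ m (p : ℕ → Bool) → T (any< m p) → ∃ λ k → k < m × T (p k)
  any<⁻ (suc m) p h with T-∨ {p m} .to h
  ... | inj₁ pm = m , ≤-refl , pm
  ... | inj₂ h′ = let (k , k<m , pk) = any<⁻ m p h′ in k , m<n⇒m<1+n k<m , pk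

  all<⁺ : ∀ m (p : ℕ → Bool) → (∀ k → k < m → T (p k)) → T (all< m p)
  all<⁺ zero    p h = _
  all<⁺ (suc m) p h = T-∧ .from (h m ≤-refl , all<⁺ m p (λ k k<m → h k (m<n⇒m<1+n k<m)))

  all<⁻ : ∀ {m k} (p : ℕ → Bool) → T (all< m p) → k < m → T (p k)
  all<⁻ {suc m} p h k<1+m with T-∧ {p m} .to h | m≤n⇒m<n∨m≡n k<1+m
  ... | (pm , _) | inj₂ refl = pm
  ... | (_ , h′) | inj₁ k<m  = all<⁻ p h′ (≤-pred k<m)

opaque

  triangle : ℕ → ℕ
  triangle = natrec 0 (λ k t → suc k + t)

  -- diagonal z is the d with triangle d ≤ z ≤ triangle d + d; ⟨ a , b ⟩ lies on diagonal a + b.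
  diagonal : ℕ → ℕ
  diagonal = natrec 0 (λ z d → if triangle (suc d) ≡ᵇ suc z then suc d else d)

  infix 10 ⟨_,_⟩

  ⟨_,_⟩ : ℕ → ℕ → ℕ
  ⟨ a , b ⟩ = triangle (a + b) + a

  π₁ : ℕ → ℕ
  π₁ z = z ∸ triangle (diagonal z)

  π₂ : ℕ → ℕ
  π₂ z = diagonal z ∸ π₁ z

  diagonal-bounds : ∀ z → triangle (diagonal z) ≤ z × z ≤ triangle (diagonal z) + diagonal z
  diagonal-bounds zero = z≤n , z≤n
  diagonal-bounds (suc z) with diagonal z | diagonal-bounds z
  ... | d | (lo , hi) with triangle (suc d) ≡ᵇ suc z in eq
  ... | true  = let t≡z = ≡ᵇ⇒≡ _ _ (subst T (sym eq) _) in
                ≤-reflexive t≡z , ≤-trans (≤-reflexive (sym t≡z)) (m≤m+n (triangle (suc d)) (suc d))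
  ... | false = m≤n⇒m≤1+n lo , z<t+d
    where
    z<t+d : suc z ≤ triangle d + d
    z<t+d with m≤n⇒m<n∨m≡n (s≤s hi)
    ... | inj₁ lt = ≤-pred lt
    ... | inj₂ e  = contradiction (≡⇒≡ᵇ _ _ (trans (cong suc (+-comm d (triangle d))) (sym e))) (subst T eq)

  triangle-gap : ∀ {d d′} → d < d′ → triangle d + d < triangle d′
  triangle-gap {d} {suc d′} (s≤s d≤d′) with m≤n⇒m<n∨m≡n d≤d′
  ... | inj₁ d<d′ = ≤-trans (≤-trans (triangle-gap d<d′) (m≤n+m (triangle d′) d′)) (n≤1+n _)
  ... | inj₂ refl = ≤-reflexive (cong suc (+-comm (triangle d) d))

  diagonal-unique : ∀ z d → triangle d ≤ z → z ≤ triangle d + d → diagonal z ≡ d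
  diagonal-unique z d lo hi with <-cmp (diagonal z) d
  ... | tri< lt _ _ = contradiction lo (<⇒≱ (≤-trans (s≤s (proj₂ (diagonal-bounds z))) (triangle-gap lt)))
  ... | tri≈ _ e _  = e
  ... | tri> _ _ gt = contradiction (proj₁ (diagonal-bounds z)) (<⇒≱ (≤-trans (s≤s hi) (triangle-gap gt)))

  diagonal-⟨⟩ : ∀ a b → diagonal ⟨ a , b ⟩ ≡ a + b
  diagonal-⟨⟩ a b = diagonal-unique ⟨ a , b ⟩ (a + b) (m≤m+n _ _) (+-monoʳ-≤ (triangle (a + b)) (m≤m+n a b))

  π₁-⟨⟩ : ∀ a b → π₁ ⟨ a , b ⟩ ≡ a
  π₁-⟨⟩ a b rewrite diagonal-⟨⟩ a b = m+n∸m≡n (triangle (a + b)) a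

  π₂-⟨⟩ : ∀ a b → π₂ ⟨ a , b ⟩ ≡ b
  π₂-⟨⟩ a b rewrite π₁-⟨⟩ a b | diagonal-⟨⟩ a b = m+n∸m≡n a b

  ⟨π₁,π₂⟩ : ∀ z → ⟨ π₁ z , π₂ z ⟩ ≡ z
  ⟨π₁,π₂⟩ z = begin
    triangle (π₁ z + (d ∸ π₁ z)) + π₁ z ≡⟨ cong (λ s → triangle s + π₁ z) (m+[n∸m]≡n π₁≤d) ⟩
    triangle d + (z ∸ triangle d)       ≡⟨ +-comm (triangle d) _ ⟩
    (z ∸ triangle d) + triangle d       ≡⟨ m∸n+n≡m (proj₁ (diagonal-bounds z)) ⟩
    z                                   ∎
    where
    open ≡-Reasoning
    d : ℕ
    d = diagonal z
    π₁≤d : π₁ z ≤ d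
    π₁≤d = subst (π₁ z ≤_) (m+n∸m≡n (triangle d) d) (∸-monoˡ-≤ (triangle d) (proj₂ (diagonal-bounds z)))

  ⟨⟩-≥₂ : ∀ a b → b ≤ ⟨ a , b ⟩
  ⟨⟩-≥₂ a b = ≤-trans (m≤n+m b a) (≤-trans (triangle-≥ (a + b)) (m≤m+n _ a))
    where
    triangle-≥ : ∀ d → d ≤ triangle d
    triangle-≥ zero    = z≤n
    triangle-≥ (suc d) = m≤m+n (suc d) _

  π₂-0 : π₂ 0 ≡ 0
  π₂-0 = refl

  triangle-computable : Computable 1 triangle
  triangle-computable = fromV (natrecᶜ (constᶜ 0) (+-computable $ᶜ sucᶜ x₀ ∷ x₁ ∷ []))

  diagonal-computable : Computable 1 diagonal
  diagonal-computable = fromV (natrecᶜ (constᶜ 0)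
    (ifᶜ (≡ᵇᶜ (triangle-computable $ᶜ sucᶜ x₁ ∷ []) (sucᶜ x₀)) (sucᶜ x₁) x₁))

  ⟨⟩-computable : Computable 2 ⟨_,_⟩
  ⟨⟩-computable = fromV (+-computable $ᶜ (triangle-computable $ᶜ (+-computable $ᶜ x₀ ∷ x₁ ∷ []) ∷ []) ∷ x₀ ∷ [])

  π₁-computable : Computable 1 π₁
  π₁-computable = fromV (∸-computable $ᶜ x₀ ∷ (triangle-computable $ᶜ (diagonal-computable $ᶜ x₀ ∷ []) ∷ []) ∷ [])

  π₂-computable : Computable 1 π₂
  π₂-computable = fromV (∸-computable $ᶜ (diagonal-computable $ᶜ x₀ ∷ []) ∷ (π₁-computable $ᶜ x₀ ∷ []) ∷ [])

cons : ℕ → ℕ → ℕ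
cons a l = suc ⟨ a , l ⟩

hd : ℕ → ℕ
hd N = π₁ (pred N)

tl : ℕ → ℕ
tl N = π₂ (pred N)

hd-cons : ∀ a l → hd (cons a l) ≡ a
hd-cons = π₁-⟨⟩

tl-cons : ∀ a l → tl (cons a l) ≡ l
tl-cons = π₂-⟨⟩

cons-hd-tl : ∀ N → cons (hd (suc N)) (tl (suc N)) ≡ suc N
cons-hd-tl N = cong suc (⟨π₁,π₂⟩ N)

tl<suc : ∀ N → tl (suc N) < suc N
tl<suc N = s≤s (subst (π₂ N ≤_) (⟨π₁,π₂⟩ N) (⟨⟩-≥₂ (π₁ N) (π₂ N)))

⌜_⌝ˡ : List ℕ → ℕ
⌜ [] ⌝ˡ    = 0
⌜ x ∷ l ⌝ˡ = cons x ⌜ l ⌝ˡ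

⌜⌝ˡ-surjective : ∀ N → ∃ λ l → ⌜ l ⌝ˡ ≡ N
⌜⌝ˡ-surjective = <-rec _ decode
  where
  decode : ∀ N → (∀ {M} → M < N → ∃ λ l → ⌜ l ⌝ˡ ≡ M) → ∃ λ l → ⌜ l ⌝ˡ ≡ N
  decode zero    _   = [] , refl
  decode (suc N) rec = let (l , ⌜l⌝≡tl) = rec (tl<suc N) in
    hd (suc N) ∷ l , trans (cong (cons (hd (suc N))) ⌜l⌝≡tl) (cons-hd-tl N)

suffix : ℕ → ℕ → ℕ
suffix k N = iter tl k N

suffix-cons : ∀ k x l → suffix (suc k) (cons x l) ≡ suffix k l
suffix-cons k x l = trans (iter-suc tl k (cons x l)) (cong (suffix k) (tl-cons x l))

suffix-0 : ∀ k → suffix k 0 ≡ 0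
suffix-0 zero    = refl
suffix-0 (suc k) = trans (cong tl (suffix-0 k)) π₂-0

suffix≢0⇒< : ∀ k N → suffix k N ≢ 0 → k < N
suffix≢0⇒< k       zero    s≢0 = contradiction (suffix-0 k) s≢0
suffix≢0⇒< zero    (suc N) _   = s≤s z≤n
suffix≢0⇒< (suc k) (suc N) s≢0 =
  <-≤-trans (s≤s (suffix≢0⇒< k (tl (suc N)) (s≢0 ∘ trans (iter-suc tl k (suc N))))) (tl<suc N)

atSuffix : (ℕ → ℕ → Bool) → ℕ → ℕ → Bool
atSuffix Q N k = not (suffix k N ≡ᵇ 0) ∧ Q (hd (suffix k N)) (tl (suffix k N))

anySuffix : (ℕ → ℕ → Bool) → ℕ → Bool
anySuffix Q N = any< N (atSuffix Q N)

data AnySuffix (Q : ℕ → ℕ → Bool) : List ℕ → Set where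
  here  : ∀ {x l} → T (Q x ⌜ l ⌝ˡ) → AnySuffix Q (x ∷ l)
  there : ∀ {x l} → AnySuffix Q l → AnySuffix Q (x ∷ l)

module _ (Q : ℕ → ℕ → Bool) where

  atSuffix-head : ∀ x l → T (atSuffix Q ⌜ x ∷ l ⌝ˡ 0) ⇔ T (Q x ⌜ l ⌝ˡ)
  atSuffix-head x l = subst (λ b → T b ⇔ T (Q x ⌜ l ⌝ˡ))
    (sym (cong₂ Q (hd-cons x ⌜ l ⌝ˡ) (tl-cons x ⌜ l ⌝ˡ))) (mk⇔ id id)

  atSuffix-cons : ∀ k x l → atSuffix Q ⌜ x ∷ l ⌝ˡ (suc k) ≡ atSuffix Q ⌜ l ⌝ˡ k
  atSuffix-cons k x l = cong (λ S → not (S ≡ᵇ 0) ∧ Q (hd S) (tl S)) (suffix-cons k x ⌜ l ⌝ˡ)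

  atSuffix-emptied : ∀ N k → suffix k N ≡ 0 → ¬ T (atSuffix Q N k)
  atSuffix-emptied N k S≡0 = subst (λ S → ¬ T (not (S ≡ᵇ 0) ∧ Q (hd S) (tl S))) (sym S≡0) (λ ())

  atSuffix⇒< : ∀ N k → T (atSuffix Q N k) → k < N
  atSuffix⇒< N k at = suffix≢0⇒< k N λ S≡0 → atSuffix-emptied N k S≡0 at

  AnySuffix⇒atSuffix : ∀ {l} → AnySuffix Q l → ∃ λ k → T (atSuffix Q ⌜ l ⌝ˡ k)
  AnySuffix⇒atSuffix {x ∷ l} (here q)  = 0 , atSuffix-head x l .from q
  AnySuffix⇒atSuffix {x ∷ l} (there s) =
    let (k , at) = AnySuffix⇒atSuffix s in suc k , subst T (sym (atSuffix-cons k x l)) at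

  atSuffix⇒AnySuffix : ∀ l k → T (atSuffix Q ⌜ l ⌝ˡ k) → AnySuffix Q l
  atSuffix⇒AnySuffix []      k       at = contradiction at (atSuffix-emptied 0 k (suffix-0 k))
  atSuffix⇒AnySuffix (x ∷ l) zero    at = here (atSuffix-head x l .to at)
  atSuffix⇒AnySuffix (x ∷ l) (suc k) at = there (atSuffix⇒AnySuffix l k (subst T (atSuffix-cons k x l) at))

  anySuffix⁺ : ∀ {l} → AnySuffix Q l → T (anySuffix Q ⌜ l ⌝ˡ)
  anySuffix⁺ {l} s = let (k , at) = AnySuffix⇒atSuffix s in any<⁺ (atSuffix Q ⌜ l ⌝ˡ) (atSuffix⇒< _ k at) at

  anySuffix⁻ : ∀ l → T (anySuffix Q ⌜ l ⌝ˡ) → AnySuffix Q l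
  anySuffix⁻ l h = let (k , _ , at) = any<⁻ ⌜ l ⌝ˡ (atSuffix Q ⌜ l ⌝ˡ) h in atSuffix⇒AnySuffix l k at

anyEl : (ℕ → Bool) → ℕ → Bool
anyEl Q = anySuffix (λ x _ → Q x)

module _ (Q : ℕ → Bool) where

  anyEl⁺ : ∀ {l} → Any (T ∘ Q) l → T (anyEl Q ⌜ l ⌝ˡ)
  anyEl⁺ = anySuffix⁺ _ ∘ toSuffix
    where
    toSuffix : ∀ {l} → Any (T ∘ Q) l → AnySuffix (λ x _ → Q x) l
    toSuffix (here q)  = here q
    toSuffix (there a) = there (toSuffix a)

  anyEl⁻ : ∀ l → T (anyEl Q ⌜ l ⌝ˡ) → Any (T ∘ Q) l
  anyEl⁻ l = fromSuffix ∘ anySuffix⁻ _ l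
    where
    fromSuffix : ∀ {l} → AnySuffix (λ x _ → Q x) l → Any (T ∘ Q) l
    fromSuffix (here q)  = here q
    fromSuffix (there s) = there (fromSuffix s)

hd-computable : Computable 1 hd
hd-computable = fromV (π₁-computable $ᶜ (pred-computable $ᶜ x₀ ∷ []) ∷ [])

tl-computable : Computable 1 tl
tl-computable = fromV (π₂-computable $ᶜ (pred-computable $ᶜ x₀ ∷ []) ∷ [])

cons-computable : Computable 2 cons
cons-computable = fromV (sucᶜ (⟨⟩-computable $ᶜ x₀ ∷ x₁ ∷ []))

anySuffixᶜ : {Q : Vec ℕ (2 + n) → Bool} {N : Vec ℕ n → ℕ} → DecidableV (2 + n) Q → ComputableV n N →
             DecidableV n (λ xs → anySuffix (λ h t → Q (h ∷ t ∷ xs)) (N xs))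
anySuffixᶜ {n = n} {N = N} cQ cN =
  any<ᶜ (∧ᶜ (notᶜ (≡ᵇᶜ S (constᶜ 0))) (prependᶜ cQ ((hd-computable $ᶜ S ∷ []) ∷ (tl-computable $ᶜ S ∷ []) ∷ []))) cN
  where
  S : ComputableV (suc n) (λ ys → suffix (lookup ys (# 0)) (N (tail ys)))
  S = iter-computable tl-computable $ᶜ x₀ ∷ prependᶜ cN [] ∷ []

anyElᶜ : {Q : Vec ℕ (suc n) → Bool} {N : Vec ℕ n → ℕ} → DecidableV (suc n) Q → ComputableV n N →
         DecidableV n (λ xs → anyEl (λ h → Q (h ∷ xs)) (N xs))
anyElᶜ cQ cN = anySuffixᶜ (skip₁ᶜ cQ) cN

opaque

  infix 7 _∈ᵇ_

  _∈ᵇ_ : ℕ → ℕ → Bool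
  J ∈ᵇ N = anyEl (J ≡ᵇ_) N

  ∈ᵇ⁺ : ∀ {J l} → J ∈ l → T (J ∈ᵇ ⌜ l ⌝ˡ)
  ∈ᵇ⁺ {J} = anyEl⁺ _ ∘ Any.map (≡⇒≡ᵇ J _)

  ∈ᵇ⁻ : ∀ {J} l → T (J ∈ᵇ ⌜ l ⌝ˡ) → J ∈ l
  ∈ᵇ⁻ {J} l = Any.map (≡ᵇ⇒≡ J _) ∘ anyEl⁻ _ l

  ∈ᵇ-computable : Computable 2 (λ J N → fromBool (J ∈ᵇ N))
  ∈ᵇ-computable = fromV (anyElᶜ (≡ᵇᶜ x₁ x₀) x₁)

mutual
  ⌜_⌝ : Code n → ℕ
  ⌜ zer ⌝       = ⟨ 0 , 0 ⟩
  ⌜ succ ⌝      = ⟨ 1 , 0 ⟩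
  ⌜ proj i ⌝    = ⟨ 2 , finToℕ i ⟩
  ⌜ comp f gs ⌝ = ⟨ 3 , ⟨ ⌜ f ⌝ , ⌜ gs ⌝* ⟩ ⟩
  ⌜ prec f g ⌝  = ⟨ 4 , ⟨ ⌜ f ⌝ , ⌜ g ⌝ ⟩ ⟩
  ⌜ mu f ⌝      = ⟨ 5 , ⌜ f ⌝ ⟩

  ⌜_⌝* : {m : ℕ} → Vec (Code n) m → ℕ
  ⌜ [] ⌝*     = 0
  ⌜ g ∷ gs ⌝* = cons ⌜ g ⌝ ⌜ gs ⌝*

⌜_⌝ᵛ : Vec ℕ n → ℕ
⌜ [] ⌝ᵛ     = 0
⌜ x ∷ xs ⌝ᵛ = cons x ⌜ xs ⌝ᵛ

-- ⌜Eval⌝ c x v is the judgement that the code numbered c maps the input numbered x to v. A certificate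
-- is a coded list of judgements, each following by one rule of Eval from judgements further down the
-- list. Premises with unknown outputs are found by searching the list (anyOutput), which is why the
-- output is the last component of a judgement.
⌜Eval⌝ : ℕ → ℕ → ℕ → ℕ
⌜Eval⌝ c x v = ⟨ 0 , ⟨ c , ⟨ x , v ⟩ ⟩ ⟩

⌜EvalAll⌝ : ℕ → ℕ → ℕ → ℕ
⌜EvalAll⌝ g x y = ⟨ 1 , ⟨ g , ⟨ x , y ⟩ ⟩ ⟩

output : ℕ → ℕ
output J = π₂ (π₂ (π₂ J))

output-⌜Eval⌝ : ∀ c x v → output (⌜Eval⌝ c x v) ≡ v
output-⌜Eval⌝ c x v = trans (cong (π₂ ∘ π₂) (π₂-⟨⟩ 0 _)) (trans (cong π₂ (π₂-⟨⟩ c _)) (π₂-⟨⟩ x v))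

output-⌜EvalAll⌝ : ∀ g x y → output (⌜EvalAll⌝ g x y) ≡ y
output-⌜EvalAll⌝ g x y = trans (cong (π₂ ∘ π₂) (π₂-⟨⟩ 1 _)) (trans (cong π₂ (π₂-⟨⟩ g _)) (π₂-⟨⟩ x y))

⌜Eval⌝-computable : Computable 3 ⌜Eval⌝
⌜Eval⌝-computable = fromV (⟨⟩-computable $ᶜ constᶜ 0 ∷ (⟨⟩-computable $ᶜ x₀ ∷ (⟨⟩-computable $ᶜ x₁ ∷ x₂ ∷ []) ∷ []) ∷ [])

⌜EvalAll⌝-computable : Computable 3 ⌜EvalAll⌝
⌜EvalAll⌝-computable = fromV (⟨⟩-computable $ᶜ constᶜ 1 ∷ (⟨⟩-computable $ᶜ x₀ ∷ (⟨⟩-computable $ᶜ x₁ ∷ x₂ ∷ []) ∷ []) ∷ [])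

output-computable : Computable 1 output
output-computable = fromV (π₂-computable $ᶜ (π₂-computable $ᶜ (π₂-computable $ᶜ x₀ ∷ []) ∷ []) ∷ [])

opaque

  judgedWith : (ℕ → ℕ) → (ℕ → Bool) → ℕ → Bool
  judgedWith J P h = (h ≡ᵇ J (output h)) ∧ P (output h)

  anyOutput : (ℕ → ℕ) → (ℕ → Bool) → ℕ → Bool
  anyOutput J P = anyEl (judgedWith J P)

  anyOutput⁺ : ∀ {J} → (∀ r → output (J r) ≡ r) → ∀ P {l r} → J r ∈ l → T (P r) → T (anyOutput J P ⌜ l ⌝ˡ)
  anyOutput⁺ {J} output-J P {r = r} Jr∈l Pr = anyEl⁺ (judgedWith J P)
    (lose Jr∈l (T-∧ .from (≡⇒≡ᵇ (J r) _ (cong J (sym (output-J r))) , subst (T ∘ P) (sym (output-J r)) Pr)))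

  anyOutput⁻ : ∀ {J} → (∀ r → output (J r) ≡ r) → ∀ P l → T (anyOutput J P ⌜ l ⌝ˡ) → ∃ λ r → J r ∈ l × T (P r)
  anyOutput⁻ {J} output-J P l h with find (anyEl⁻ (judgedWith J P) l h)
  ... | h′ , h′∈l , q with T-∧ .to q
  ... | h′≡J , Pr = output h′ , subst (_∈ l) (≡ᵇ⇒≡ h′ _ h′≡J) h′∈l , Pr

  anyOutputᶜ : {J : Vec ℕ (suc n) → ℕ} {P : Vec ℕ (suc n) → Bool} {N : Vec ℕ n → ℕ} →
               ComputableV (suc n) J → DecidableV (suc n) P → ComputableV n N →
               DecidableV n (λ xs → anyOutput (λ r → J (r ∷ xs)) (λ r → P (r ∷ xs)) (N xs))
  anyOutputᶜ {n = n} cJ cP = anyElᶜ (∧ᶜ (≡ᵇᶜ x₀ (prependᶜ cJ (out ∷ []))) (prependᶜ cP (out ∷ [])))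
    where
    out : ComputableV (suc n) (λ ys → output (lookup ys (# 0)))
    out = output-computable $ᶜ x₀ ∷ []

  anyOutput-mono : ∀ {l l′} → l ⊆ l′ → ∀ {J} {P P′ : ℕ → Bool} → (∀ {r} → T (P r) → T (P′ r)) →
                   T (anyOutput J P ⌜ l ⌝ˡ) → T (anyOutput J P′ ⌜ l′ ⌝ˡ)
  anyOutput-mono {l} l⊆l′ {J} {P} {P′} P⇒P′ =
    anyEl⁺ (judgedWith J P′) ∘ Any-resp-⊆ l⊆l′ ∘ Any.map (∧-monoᵀ id P⇒P′) ∘ anyEl⁻ (judgedWith J P) l

precRule : (f g c y x v R : ℕ) → Bool
precRule f g c zero    x v R = ⌜Eval⌝ f x v ∈ᵇ R
precRule f g c (suc y) x v R = anyOutput (⌜Eval⌝ c (cons y x)) (λ r → ⌜Eval⌝ g (cons y (cons r x)) v ∈ᵇ R) R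

evalRule : (t b x v R : ℕ) → Bool
evalRule 0 _ x v R = v ≡ᵇ 0
evalRule 1 _ x v R = v ≡ᵇ suc (hd x)
evalRule 2 i x v R = v ≡ᵇ hd (suffix i x)
evalRule 3 b x v R = anyOutput (⌜EvalAll⌝ (π₂ b) x) (λ ys → ⌜Eval⌝ (π₁ b) ys v ∈ᵇ R) R
evalRule 4 b x v R = precRule (π₁ b) (π₂ b) ⟨ 4 , b ⟩ (hd x) (tl x) v R  -- ⟨ 4 , b ⟩ numbers prec f g itself
evalRule (suc (suc (suc (suc (suc _))))) f x v R =
  ⌜Eval⌝ f (cons v x) 0 ∈ᵇ R ∧ all< v (λ z → anyOutput (⌜Eval⌝ f (cons z x)) (λ w → not (w ≡ᵇ 0)) R)

evalAllRule : (g x y R : ℕ) → Bool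
evalAllRule zero    x y R = y ≡ᵇ 0
evalAllRule (suc g) x y R =
  not (y ≡ᵇ 0) ∧ (⌜Eval⌝ (hd (suc g)) x (hd y) ∈ᵇ R ∧ ⌜EvalAll⌝ (tl (suc g)) x (tl y) ∈ᵇ R)

judgementRule : (tag s x v R : ℕ) → Bool
judgementRule zero    s x v R = evalRule (π₁ s) (π₂ s) x v R
judgementRule (suc _) s x v R = evalAllRule s x v R

justified : ℕ → ℕ → Bool
justified J R = judgementRule (π₁ J) (π₁ (π₂ J)) (π₁ (π₂ (π₂ J))) (output J) R

precRule-computable : Computable 7 (λ f g c y x v R → fromBool (precRule f g c y x v R))
precRule-computable = fromV-≗
  (λ { (f ∷ g ∷ c ∷ zero ∷ x ∷ v ∷ R ∷ []) → refl ; (f ∷ g ∷ c ∷ suc y ∷ x ∷ v ∷ R ∷ []) → refl })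
  (ifᵇᶜ (≡ᵇᶜ x₃ (constᶜ 0))
    (∈ᵇ-computable $ᶜ (⌜Eval⌝-computable $ᶜ x₀ ∷ x₄ ∷ x₅ ∷ []) ∷ x₆ ∷ [])
    (anyOutputᶜ (⌜Eval⌝-computable $ᶜ x₃ ∷ (cons-computable $ᶜ pred-y ∷ x₅ ∷ []) ∷ x₀ ∷ [])
                (∈ᵇ-computable $ᶜ (⌜Eval⌝-computable $ᶜ x₂ ∷ (cons-computable $ᶜ pred-y ∷ (cons-computable $ᶜ x₀ ∷ x₅ ∷ []) ∷ [])
                                                        ∷ x₆ ∷ [])
                                  ∷ x₇ ∷ [])
                x₆))
  where
  pred-y : ComputableV 8 (λ xs → pred (lookup xs (# 4)))
  pred-y = pred-computable $ᶜ x₄ ∷ []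

evalRule-computable : Computable 5 (λ t b x v R → fromBool (evalRule t b x v R))
evalRule-computable = fromV-≗
  (λ { (0 ∷ b ∷ x ∷ v ∷ R ∷ []) → refl ; (1 ∷ b ∷ x ∷ v ∷ R ∷ []) → refl ; (2 ∷ b ∷ x ∷ v ∷ R ∷ []) → refl
     ; (3 ∷ b ∷ x ∷ v ∷ R ∷ []) → refl ; (4 ∷ b ∷ x ∷ v ∷ R ∷ []) → refl
     ; (suc (suc (suc (suc (suc t)))) ∷ b ∷ x ∷ v ∷ R ∷ []) → refl })
  (ifᵇᶜ (≡ᵇᶜ x₀ (constᶜ 0)) (≡ᵇᶜ x₃ (constᶜ 0))
  (ifᵇᶜ (≡ᵇᶜ x₀ (constᶜ 1)) (≡ᵇᶜ x₃ (sucᶜ (hd-computable $ᶜ x₂ ∷ [])))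
  (ifᵇᶜ (≡ᵇᶜ x₀ (constᶜ 2)) (≡ᵇᶜ x₃ (hd-computable $ᶜ (iter-computable tl-computable $ᶜ x₁ ∷ x₂ ∷ []) ∷ []))
  (ifᵇᶜ (≡ᵇᶜ x₀ (constᶜ 3))
    (anyOutputᶜ (⌜EvalAll⌝-computable $ᶜ (π₂-computable $ᶜ x₂ ∷ []) ∷ x₃ ∷ x₀ ∷ [])
                (∈ᵇ-computable $ᶜ (⌜Eval⌝-computable $ᶜ (π₁-computable $ᶜ x₂ ∷ []) ∷ x₀ ∷ x₄ ∷ []) ∷ x₅ ∷ [])
                x₄)
  (ifᵇᶜ (≡ᵇᶜ x₀ (constᶜ 4))
    (precRule-computable $ᶜ (π₁-computable $ᶜ x₁ ∷ []) ∷ (π₂-computable $ᶜ x₁ ∷ []) ∷ (⟨⟩-computable $ᶜ constᶜ 4 ∷ x₁ ∷ [])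
                          ∷ (hd-computable $ᶜ x₂ ∷ []) ∷ (tl-computable $ᶜ x₂ ∷ []) ∷ x₃ ∷ x₄ ∷ [])
    (∧ᶜ (∈ᵇ-computable $ᶜ (⌜Eval⌝-computable $ᶜ x₁ ∷ (cons-computable $ᶜ x₃ ∷ x₂ ∷ []) ∷ constᶜ 0 ∷ []) ∷ x₄ ∷ [])
        (all<ᶜ (anyOutputᶜ (⌜Eval⌝-computable $ᶜ x₃ ∷ (cons-computable $ᶜ x₁ ∷ x₄ ∷ []) ∷ x₀ ∷ [])
                           (notᶜ (≡ᵇᶜ x₀ (constᶜ 0)))
                           x₅)
               x₃)))))))

evalAllRule-computable : Computable 4 (λ g x y R → fromBool (evalAllRule g x y R))
evalAllRule-computable = fromV-≗ (λ { (zero ∷ x ∷ y ∷ R ∷ []) → refl ; (suc g ∷ x ∷ y ∷ R ∷ []) → refl })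
  (ifᵇᶜ (≡ᵇᶜ x₀ (constᶜ 0)) (≡ᵇᶜ x₂ (constᶜ 0))
    (∧ᶜ (notᶜ (≡ᵇᶜ x₂ (constᶜ 0)))
        (∧ᶜ (∈ᵇ-computable $ᶜ (⌜Eval⌝-computable $ᶜ (hd-computable $ᶜ x₀ ∷ []) ∷ x₁ ∷ (hd-computable $ᶜ x₂ ∷ []) ∷ [])
                          ∷ x₃ ∷ [])
            (∈ᵇ-computable $ᶜ (⌜EvalAll⌝-computable $ᶜ (tl-computable $ᶜ x₀ ∷ []) ∷ x₁ ∷ (tl-computable $ᶜ x₂ ∷ []) ∷ [])
                          ∷ x₃ ∷ []))))

justified-computable : Computable 2 (λ J R → fromBool (justified J R))
justified-computable = fromV-≗ (λ { (J ∷ R ∷ []) → judgementRule-if (π₁ J) })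
  (ifᵇᶜ (≡ᵇᶜ tag (constᶜ 0))
    (evalRule-computable $ᶜ (π₁-computable $ᶜ s ∷ []) ∷ (π₂-computable $ᶜ s ∷ []) ∷ x ∷ v ∷ x₁ ∷ [])
    (evalAllRule-computable $ᶜ s ∷ x ∷ v ∷ x₁ ∷ []))
  where
  judgementRule-if : ∀ {s x v R} tag → fromBool (if tag ≡ᵇ 0 then evalRule (π₁ s) (π₂ s) x v R else evalAllRule s x v R)
                                       ≡ fromBool (judgementRule tag s x v R)
  judgementRule-if zero    = refl
  judgementRule-if (suc _) = refl
  tag : ComputableV 2 (λ xs → π₁ (lookup xs (# 0)))
  tag = π₁-computable $ᶜ x₀ ∷ []
  s : ComputableV 2 (λ xs → π₁ (π₂ (lookup xs (# 0))))
  s = π₁-computable $ᶜ (π₂-computable $ᶜ x₀ ∷ []) ∷ []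
  x : ComputableV 2 (λ xs → π₁ (π₂ (π₂ (lookup xs (# 0)))))
  x = π₁-computable $ᶜ (π₂-computable $ᶜ (π₂-computable $ᶜ x₀ ∷ []) ∷ []) ∷ []
  v : ComputableV 2 (λ xs → output (lookup xs (# 0)))
  v = output-computable $ᶜ x₀ ∷ []

justified-⟨⟩ : ∀ tag s x v R → justified ⟨ tag , ⟨ s , ⟨ x , v ⟩ ⟩ ⟩ R ≡ judgementRule tag s x v R
justified-⟨⟩ tag s x v R
  rewrite π₁-⟨⟩ tag ⟨ s , ⟨ x , v ⟩ ⟩ | π₂-⟨⟩ tag ⟨ s , ⟨ x , v ⟩ ⟩ | π₁-⟨⟩ s ⟨ x , v ⟩ | π₂-⟨⟩ s ⟨ x , v ⟩
        | π₁-⟨⟩ x v | π₂-⟨⟩ x v = refl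

justified-⌜Eval⌝ : ∀ t b x v R → justified (⌜Eval⌝ ⟨ t , b ⟩ x v) R ≡ evalRule t b x v R
justified-⌜Eval⌝ t b x v R =
  trans (justified-⟨⟩ 0 _ x v R) (cong₂ (λ t b → evalRule t b x v R) (π₁-⟨⟩ t b) (π₂-⟨⟩ t b))

justified-⌜EvalAll⌝ : ∀ g x y R → justified (⌜EvalAll⌝ g x y) R ≡ evalAllRule g x y R
justified-⌜EvalAll⌝ g x y R = justified-⟨⟩ 1 g x y R

justified-succ : ∀ x v R → justified (⌜Eval⌝ ⌜ succ ⌝ (cons x 0) v) R ≡ (v ≡ᵇ suc x)
justified-succ x v R = trans (justified-⌜Eval⌝ 1 0 _ v R) (cong (λ a → v ≡ᵇ suc a) (hd-cons x 0))

justified-comp : ∀ {n m} (f : Code m) (gs : Vec (Code n) m) x v R →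
                 justified (⌜Eval⌝ ⌜ comp f gs ⌝ x v) R ≡ anyOutput (⌜EvalAll⌝ ⌜ gs ⌝* x) (λ ys → ⌜Eval⌝ ⌜ f ⌝ ys v ∈ᵇ R) R
justified-comp f gs x v R = trans (justified-⌜Eval⌝ 3 _ x v R)
  (cong₂ (λ a b → anyOutput (⌜EvalAll⌝ b x) (λ ys → ⌜Eval⌝ a ys v ∈ᵇ R) R) (π₁-⟨⟩ _ _) (π₂-⟨⟩ _ _))

justified-prec : ∀ {n} (f : Code n) (g : Code (2 + n)) y x v R →
                 justified (⌜Eval⌝ ⌜ prec f g ⌝ (cons y x) v) R ≡ precRule ⌜ f ⌝ ⌜ g ⌝ ⌜ prec f g ⌝ y x v R
justified-prec f g y x v R = trans (justified-⌜Eval⌝ 4 _ _ v R)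
  (trans (cong₂ (λ a b → precRule a b ⌜ prec f g ⌝ (hd (cons y x)) (tl (cons y x)) v R) (π₁-⟨⟩ _ _) (π₂-⟨⟩ _ _))
         (cong₂ (λ a b → precRule ⌜ f ⌝ ⌜ g ⌝ ⌜ prec f g ⌝ a b v R) (hd-cons y x) (tl-cons y x)))

justified-∷ : ∀ g gs x y ys R → justified (⌜EvalAll⌝ (cons g gs) x (cons y ys)) R ≡
                                  (⌜Eval⌝ g x y ∈ᵇ R ∧ ⌜EvalAll⌝ gs x ys ∈ᵇ R)
justified-∷ g gs x y ys R = trans (justified-⌜EvalAll⌝ _ x _ R)
  (trans (cong₂ (λ a b → ⌜Eval⌝ a x (hd (cons y ys)) ∈ᵇ R ∧ ⌜EvalAll⌝ b x (tl (cons y ys)) ∈ᵇ R)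
                (hd-cons g gs) (tl-cons g gs))
         (cong₂ (λ a b → ⌜Eval⌝ g x a ∈ᵇ R ∧ ⌜EvalAll⌝ gs x b ∈ᵇ R) (hd-cons y ys) (tl-cons y ys)))

data Certificate : List ℕ → Set where
  []  : Certificate []
  _∷_ : ∀ {J l} → T (justified J ⌜ l ⌝ˡ) → Certificate l → Certificate (J ∷ l)

opaque

  certificate : ℕ → Bool
  certificate N = not (anySuffix (λ J R → not (justified J R)) N)

  certificate⁺ : ∀ {l} → Certificate l → T (certificate ⌜ l ⌝ˡ)
  certificate⁺ {l} c = T-not .from (noUnjustified c ∘ anySuffix⁻ _ l)
    where
    noUnjustified : ∀ {l} → Certificate l → ¬ AnySuffix (λ J R → not (justified J R)) l
    noUnjustified (j ∷ _) (here nj) = T-not .to nj j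
    noUnjustified (_ ∷ c) (there s) = noUnjustified c s

  certificate⁻ : ∀ l → T (certificate ⌜ l ⌝ˡ) → Certificate l
  certificate⁻ l h = fromNoUnjustified l (T-not .to h ∘ anySuffix⁺ _)
    where
    fromNoUnjustified : ∀ l → ¬ AnySuffix (λ J R → not (justified J R)) l → Certificate l
    fromNoUnjustified []      _    = []
    fromNoUnjustified (J ∷ l) none =
      decidable-stable (T? _) (none ∘ here ∘ T-not .from) ∷ fromNoUnjustified l (none ∘ there)

  certificate-computable : Computable 1 (λ N → fromBool (certificate N))
  certificate-computable = fromV (notᶜ (anySuffixᶜ (notᶜ (justified-computable $ᶜ x₀ ∷ x₁ ∷ [])) x₀))

hd-suffix-⌜⌝ᵛ : (X : Vec ℕ n) (i : Fin n) → hd (suffix (finToℕ i) ⌜ X ⌝ᵛ) ≡ lookup X i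
hd-suffix-⌜⌝ᵛ (x ∷ X) zero    = hd-cons x ⌜ X ⌝ᵛ
hd-suffix-⌜⌝ᵛ (x ∷ X) (suc i) = trans (cong hd (suffix-cons (finToℕ i) x ⌜ X ⌝ᵛ)) (hd-suffix-⌜⌝ᵛ X i)

-- Quantifying over all codes and inputs with the given numbers spares proving ⌜_⌝ injective.
EvalSound : ℕ → ℕ → ℕ → Set
EvalSound c x v = ∀ {n} (C : Code n) (X : Vec ℕ n) → ⌜ C ⌝ ≡ c → ⌜ X ⌝ᵛ ≡ x → Eval C X v

EvalAllSound : ℕ → ℕ → ℕ → Set
EvalAllSound g x y = ∀ {m n} (G : Vec (Code n) m) (X : Vec ℕ n) → ⌜ G ⌝* ≡ g → ⌜ X ⌝ᵛ ≡ x →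
                     ∃ λ Y → ⌜ Y ⌝ᵛ ≡ y × EvalAll G X Y

record Sound (l : List ℕ) : Set where
  field
    eval-sound    : ∀ {c x v} → ⌜Eval⌝ c x v ∈ l → EvalSound c x v
    evalAll-sound : ∀ {g x y} → ⌜EvalAll⌝ g x y ∈ l → EvalAllSound g x y

module RuleSoundness {l : List ℕ} (sound : Sound l) where

  evalIn : ∀ {n} (C : Code n) (X : Vec ℕ n) {v} → T (⌜Eval⌝ ⌜ C ⌝ ⌜ X ⌝ᵛ v ∈ᵇ ⌜ l ⌝ˡ) → Eval C X v
  evalIn C X m = Sound.eval-sound sound (∈ᵇ⁻ l m) C X refl refl

  evalRule-sound : ∀ {n} (C : Code n) (X : Vec ℕ n) {v} → T (justified (⌜Eval⌝ ⌜ C ⌝ ⌜ X ⌝ᵛ v) ⌜ l ⌝ˡ) → Eval C X v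
  evalRule-sound zer X h =
    subst (Eval zer X) (sym (≡ᵇ⇒≡ _ 0 (subst T (justified-⌜Eval⌝ 0 0 _ _ _) h))) e-zer
  evalRule-sound succ (x ∷ []) h =
    subst (Eval succ (x ∷ [])) (sym (≡ᵇ⇒≡ _ _ (subst T (justified-succ x _ _) h))) e-succ
  evalRule-sound (proj i) X h =
    subst (Eval (proj i) X) (sym (trans (≡ᵇ⇒≡ _ _ (subst T (justified-⌜Eval⌝ 2 _ _ _ _) h)) (hd-suffix-⌜⌝ᵛ X i))) e-proj
  evalRule-sound (comp f gs) X {v} h
    with anyOutput⁻ (output-⌜EvalAll⌝ _ _) (λ ys → ⌜Eval⌝ ⌜ f ⌝ ys v ∈ᵇ ⌜ l ⌝ˡ) l (subst T (justified-comp f gs _ v _) h)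
  ... | ys , gs∈l , f∈l with Sound.evalAll-sound sound gs∈l gs X refl refl
  ... | Y , refl , gs-eval = e-comp gs-eval (evalIn f Y f∈l)
  evalRule-sound (prec f g) (y ∷ X) {v} h = precCase y (subst T (justified-prec f g y _ v _) h)
    where
    precCase : ∀ y → T (precRule ⌜ f ⌝ ⌜ g ⌝ ⌜ prec f g ⌝ y ⌜ X ⌝ᵛ v ⌜ l ⌝ˡ) → Eval (prec f g) (y ∷ X) v
    precCase zero    h′ = e-prec-z (evalIn f X h′)
    precCase (suc y) h′ with anyOutput⁻ (output-⌜Eval⌝ _ _) (λ r → ⌜Eval⌝ ⌜ g ⌝ (cons y (cons r ⌜ X ⌝ᵛ)) v ∈ᵇ ⌜ l ⌝ˡ) l h′
    ... | r , rec∈l , g∈l = e-prec-s (Sound.eval-sound sound rec∈l (prec f g) (y ∷ X) refl refl) (evalIn g (y ∷ r ∷ X) g∈l)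
  evalRule-sound (mu f) X {v} h with T-∧ .to (subst T (justified-⌜Eval⌝ 5 _ _ v _) h)
  ... | zero∈l , below = e-mu (evalIn f (v ∷ X) zero∈l) λ z z<v →
    nonzero z (anyOutput⁻ (output-⌜Eval⌝ _ _) (λ w → not (w ≡ᵇ 0)) l (all<⁻ _ below z<v))
    where
    nonzero : ∀ z → (∃ λ w → ⌜Eval⌝ ⌜ f ⌝ ⌜ z ∷ X ⌝ᵛ w ∈ l × T (not (w ≡ᵇ 0))) → ∃ λ w → Eval f (z ∷ X) (suc w)
    nonzero z (suc w , m , _) = w , Sound.eval-sound sound m f (z ∷ X) refl refl

  evalAllRule-sound : ∀ {m n} (G : Vec (Code n) m) (X : Vec ℕ n) {y} →
                      T (justified (⌜EvalAll⌝ ⌜ G ⌝* ⌜ X ⌝ᵛ y) ⌜ l ⌝ˡ) → ∃ λ Y → ⌜ Y ⌝ᵛ ≡ y × EvalAll G X Y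
  evalAllRule-sound []      X h = [] , sym (≡ᵇ⇒≡ _ 0 (subst T (justified-⌜EvalAll⌝ _ _ _ _) h)) , []
  evalAllRule-sound (g ∷ G) X {zero} h with subst T (justified-⌜EvalAll⌝ _ _ _ _) h
  ... | ()
  evalAllRule-sound (g ∷ G) X {suc y} h
    with T-∧ .to (subst T (justified-∷ _ _ _ _ _ _)
                   (subst (λ y → T (justified (⌜EvalAll⌝ ⌜ g ∷ G ⌝* ⌜ X ⌝ᵛ y) ⌜ l ⌝ˡ)) (sym (cons-hd-tl y)) h))
  ... | g∈l , G∈l with Sound.evalAll-sound sound (∈ᵇ⁻ l G∈l) G X refl refl
  ... | Y , ⌜Y⌝≡tl , G-eval = hd (suc y) ∷ Y , trans (cong (cons _) ⌜Y⌝≡tl) (cons-hd-tl y) , evalIn g X g∈l ∷ G-eval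

Certificate-sound : ∀ {l} → Certificate l → Sound l
Certificate-sound []               = record { eval-sound = λ () ; evalAll-sound = λ () }
Certificate-sound {J ∷ l} (j ∷ c) = record { eval-sound = eval-sound ; evalAll-sound = evalAll-sound }
  where
  sound : Sound l
  sound = Certificate-sound c
  open RuleSoundness sound

  eval-sound : ∀ {c x v} → ⌜Eval⌝ c x v ∈ J ∷ l → EvalSound c x v
  eval-sound (here refl) C X refl refl = evalRule-sound C X j
  eval-sound (there m)                 = Sound.eval-sound sound m

  evalAll-sound : ∀ {g x y} → ⌜EvalAll⌝ g x y ∈ J ∷ l → EvalAllSound g x y
  evalAll-sound (here refl) G X refl refl = evalAllRule-sound G X j
  evalAll-sound (there m)                 = Sound.evalAll-sound sound m

certificate-sound : ∀ N {n} (C : Code n) (X : Vec ℕ n) {v} →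
                    T (certificate N) → T (⌜Eval⌝ ⌜ C ⌝ ⌜ X ⌝ᵛ v ∈ᵇ N) → Eval C X v
certificate-sound N C X cert m with ⌜⌝ˡ-surjective N
... | l , refl = Sound.eval-sound (Certificate-sound (certificate⁻ l cert)) (∈ᵇ⁻ l m) C X refl refl

module _ {l l′ : List ℕ} (l⊆l′ : l ⊆ l′) where

  ∈ᵇ-mono : ∀ {J} → T (J ∈ᵇ ⌜ l ⌝ˡ) → T (J ∈ᵇ ⌜ l′ ⌝ˡ)
  ∈ᵇ-mono = ∈ᵇ⁺ ∘ l⊆l′ ∘ ∈ᵇ⁻ l

  precRule-mono : ∀ f g c y x v → T (precRule f g c y x v ⌜ l ⌝ˡ) → T (precRule f g c y x v ⌜ l′ ⌝ˡ)
  precRule-mono f g c zero    x v = ∈ᵇ-mono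
  precRule-mono f g c (suc y) x v = anyOutput-mono l⊆l′ ∈ᵇ-mono

  evalRule-mono : ∀ t b x v → T (evalRule t b x v ⌜ l ⌝ˡ) → T (evalRule t b x v ⌜ l′ ⌝ˡ)
  evalRule-mono 0 b x v = id
  evalRule-mono 1 b x v = id
  evalRule-mono 2 b x v = id
  evalRule-mono 3 b x v = anyOutput-mono l⊆l′ ∈ᵇ-mono
  evalRule-mono 4 b x v = precRule-mono _ _ _ (hd x) (tl x) v
  evalRule-mono (suc (suc (suc (suc (suc _))))) f x v =
    ∧-monoᵀ ∈ᵇ-mono λ below → all<⁺ v _ λ z z<v → anyOutput-mono l⊆l′ id (all<⁻ _ below z<v)

  evalAllRule-mono : ∀ g x y → T (evalAllRule g x y ⌜ l ⌝ˡ) → T (evalAllRule g x y ⌜ l′ ⌝ˡ)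
  evalAllRule-mono zero    x y = id
  evalAllRule-mono (suc g) x zero    = λ ()
  evalAllRule-mono (suc g) x (suc y) = ∧-monoᵀ ∈ᵇ-mono ∈ᵇ-mono

  judgementRule-mono : ∀ tag s x v → T (judgementRule tag s x v ⌜ l ⌝ˡ) → T (judgementRule tag s x v ⌜ l′ ⌝ˡ)
  judgementRule-mono zero    s x v = evalRule-mono (π₁ s) (π₂ s) x v
  judgementRule-mono (suc _) s x v = evalAllRule-mono s x v

  justified-mono : ∀ J → T (justified J ⌜ l ⌝ˡ) → T (justified J ⌜ l′ ⌝ˡ)
  justified-mono J = judgementRule-mono (π₁ J) (π₁ (π₂ J)) (π₁ (π₂ (π₂ J))) (output J)

Certificate-++ : ∀ {l l′} → Certificate l → Certificate l′ → Certificate (l ++ l′)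
Certificate-++ []      c′ = c′
Certificate-++ {l′ = l′} (_∷_ {J} {l} j c) c′ = justified-mono (xs⊆xs++ys l l′) J j ∷ Certificate-++ c c′

Certified : ℕ → Set
Certified J = ∃ λ l → Certificate l × J ∈ l

certify : ∀ {l J} → Certificate l → T (justified J ⌜ l ⌝ˡ) → Certified J
certify c j = _ , j ∷ c , here refl

certify₂ : ∀ {J₁ J₂ J} → Certified J₁ → Certified J₂ →
           (∀ {l} → J₁ ∈ l → J₂ ∈ l → T (justified J ⌜ l ⌝ˡ)) → Certified J
certify₂ (l₁ , c₁ , m₁) (l₂ , c₂ , m₂) rule =
  certify (Certificate-++ c₁ c₂) (rule (xs⊆xs++ys l₁ l₂ m₁) (xs⊆ys++xs l₂ l₁ m₂))

mutual
  eval-certified : ∀ {n} {C : Code n} {X v} → Eval C X v → Certified (⌜Eval⌝ ⌜ C ⌝ ⌜ X ⌝ᵛ v)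
  eval-certified e-zer = certify [] (subst T (sym (justified-⌜Eval⌝ 0 0 _ 0 _)) _)
  eval-certified (e-succ {x}) = certify [] (subst T (sym (justified-succ x (suc x) _)) (≡⇒≡ᵇ x x refl))
  eval-certified (e-proj {i = i} {xs = X}) =
    certify [] (subst T (sym (justified-⌜Eval⌝ 2 _ _ _ _)) (≡⇒≡ᵇ _ _ (sym (hd-suffix-⌜⌝ᵛ X i))))
  eval-certified (e-comp {f = f} {gs} {v = v} gs-eval f-eval) =
    certify₂ (evalAll-certified gs-eval) (eval-certified f-eval) λ gs∈l f∈l →
      subst T (sym (justified-comp f gs _ v _)) (anyOutput⁺ (output-⌜EvalAll⌝ _ _) _ gs∈l (∈ᵇ⁺ f∈l))
  eval-certified (e-prec-z {f = f} {g} {v = v} f-eval) with eval-certified f-eval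
  ... | l , c , f∈l = certify c (subst T (sym (justified-prec f g 0 _ v _)) (∈ᵇ⁺ f∈l))
  eval-certified (e-prec-s {f = f} {g} {y = y} {v = v} rec-eval g-eval) =
    certify₂ (eval-certified rec-eval) (eval-certified g-eval) λ rec∈l g∈l →
      subst T (sym (justified-prec f g (suc y) _ v _)) (anyOutput⁺ (output-⌜Eval⌝ _ _) _ rec∈l (∈ᵇ⁺ g∈l))
  eval-certified (e-mu {f = f} {xs = X} {y = v} zero-eval below-eval)
    with eval-certified zero-eval | below-certified v ≤-refl
    where
    below-certified : ∀ k → k ≤ v → ∃ λ l → Certificate l × ∀ z → z < k → ∃ λ w → ⌜Eval⌝ ⌜ f ⌝ ⌜ z ∷ X ⌝ᵛ (suc w) ∈ l
    below-certified zero    _   = [] , [] , λ _ ()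
    below-certified (suc k) k<v with below-certified k (<⇒≤ k<v) | below-eval k k<v
    ... | l , c , below | w , k-eval with eval-certified k-eval
    ... | l′ , c′ , k∈l′ = l ++ l′ , Certificate-++ c c′ , λ z z<1+k → case m≤n⇒m<n∨m≡n z<1+k of λ where
      (inj₁ z<k)  → let (w′ , z∈l) = below z (≤-pred z<k) in w′ , xs⊆xs++ys l l′ z∈l
      (inj₂ refl) → w , xs⊆ys++xs l′ l k∈l′
  ... | l₁ , c₁ , zero∈l₁ | l₂ , c₂ , below = certify (Certificate-++ c₁ c₂)
    (subst T (sym (justified-⌜Eval⌝ 5 _ _ v _)) (T-∧ .from (∈ᵇ⁺ (xs⊆xs++ys l₁ l₂ zero∈l₁) , all<⁺ v _ λ z z<v →
      let (w , z∈l₂) = below z z<v in anyOutput⁺ (output-⌜Eval⌝ _ _) (λ w → not (w ≡ᵇ 0)) (xs⊆ys++xs l₂ l₁ z∈l₂) _)))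

  evalAll-certified : ∀ {m n} {G : Vec (Code n) m} {X Y} → EvalAll G X Y → Certified (⌜EvalAll⌝ ⌜ G ⌝* ⌜ X ⌝ᵛ ⌜ Y ⌝ᵛ)
  evalAll-certified [] = certify [] (subst T (sym (justified-⌜EvalAll⌝ 0 _ 0 _)) _)
  evalAll-certified (g-eval ∷ G-eval) =
    certify₂ (eval-certified g-eval) (evalAll-certified G-eval) λ g∈l G∈l →
      subst T (sym (justified-∷ _ _ _ _ _ _)) (T-∧ .from (∈ᵇ⁺ g∈l , ∈ᵇ⁺ G∈l))

haltingCertificate : ℕ → ℕ → Bool
haltingCertificate e N = certificate N ∧ anyOutput (⌜Eval⌝ e (cons e 0)) (const true) N

haltsBefore : ℕ → ℕ → Bool
haltsBefore e k = any< k (haltingCertificate e)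

haltsBefore-computable : Computable 2 (λ e k → fromBool (haltsBefore e k))
haltsBefore-computable = fromV (any<ᶜ
  (∧ᶜ (certificate-computable $ᶜ x₀ ∷ [])
      (anyOutputᶜ (⌜Eval⌝-computable $ᶜ x₂ ∷ (cons-computable $ᶜ x₂ ∷ constᶜ 0 ∷ []) ∷ x₀ ∷ []) trueᶜ x₀))
  x₁)

haltsBefore-mono : ∀ e {k k′} → k ≤ k′ → T (haltsBefore e k) → T (haltsBefore e k′)
haltsBefore-mono e k≤k′ h = let (N , N<k , cert) = any<⁻ _ _ h in any<⁺ _ (<-≤-trans N<k k≤k′) cert

haltsBefore-sound : ∀ (C : Code 1) k → T (haltsBefore ⌜ C ⌝ k) → ∃ λ v → Eval C (⌜ C ⌝ ∷ []) v
haltsBefore-sound C k h with any<⁻ k _ h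
... | N , _ , halting with ⌜⌝ˡ-surjective N
... | l , refl with T-∧ {certificate ⌜ l ⌝ˡ} .to halting
... | cert , halts with anyOutput⁻ (output-⌜Eval⌝ _ _) (const true) l halts
... | v , halt∈l , _ = v , certificate-sound ⌜ l ⌝ˡ C (⌜ C ⌝ ∷ []) cert (∈ᵇ⁺ halt∈l)

haltsBefore-complete : ∀ (C : Code 1) {v} → Eval C (⌜ C ⌝ ∷ []) v → ∃ λ k → T (haltsBefore ⌜ C ⌝ k)
haltsBefore-complete C ev with eval-certified ev
... | l , cert , halt∈l = suc ⌜ l ⌝ˡ , any<⁺ (haltingCertificate ⌜ C ⌝) (n<1+n _)
  (T-∧ .from (certificate⁺ cert , anyOutput⁺ (output-⌜Eval⌝ _ _) (const true) halt∈l _))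

SelfHalting : ℕ → Set
SelfHalting e = ∃ λ k → T (haltsBefore e k)

mutual
  Eval-deterministic : {c : Code n} {xs : Vec ℕ n} {v w : ℕ} → Eval c xs v → Eval c xs w → v ≡ w
  Eval-deterministic e-zer e-zer = refl
  Eval-deterministic e-succ e-succ = refl
  Eval-deterministic e-proj e-proj = refl
  Eval-deterministic (e-comp p f) (e-comp q g) with EvalAll-deterministic p q
  ... | refl = Eval-deterministic f g
  Eval-deterministic (e-prec-z p) (e-prec-z q) = Eval-deterministic p q
  Eval-deterministic (e-prec-s p f) (e-prec-s q g) with Eval-deterministic p q
  ... | refl = Eval-deterministic f g
  Eval-deterministic (e-mu {y = y} p ps) (e-mu {y = y′} q qs) with <-cmp y y′
  ... | tri< y<y′ _ _ = contradiction (Eval-deterministic p (proj₂ (qs y y<y′))) 0≢1+n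
  ... | tri≈ _ y≡y′ _ = y≡y′
  ... | tri> _ _ y′<y = contradiction (Eval-deterministic q (proj₂ (ps y′ y′<y))) 0≢1+n

  EvalAll-deterministic : {gs : Vec (Code n) m} {xs : Vec ℕ n} {ys zs : Vec ℕ m} →
                          EvalAll gs xs ys → EvalAll gs xs zs → ys ≡ zs
  EvalAll-deterministic [] [] = refl
  EvalAll-deterministic (p ∷ ps) (q ∷ qs) = cong₂ _∷_ (Eval-deterministic p q) (EvalAll-deterministic ps qs)

-- On input x it computes μ z (d x ≡ 0): it halts iff d rejects x.
haltsIfRejected : Code 1 → Code 1
haltsIfRejected d = comp (mu (proj (suc zero))) (d ∷ [])

rejected⇒halts : ∀ d x → Eval d (x ∷ []) 0 → Eval (haltsIfRejected d) (x ∷ []) 0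
rejected⇒halts d x d-eval = e-comp (d-eval ∷ []) (e-mu e-proj (λ _ ()))

halts⇒rejected : ∀ d x {v} → Eval (haltsIfRejected d) (x ∷ []) v → Eval d (x ∷ []) 0
halts⇒rejected d x (e-comp (d-eval ∷ []) (e-mu e-proj _)) = d-eval

SelfHalting-undecidable : ¬ RecDecidable SelfHalting
SelfHalting-undecidable (d , decides) with decides ⌜ haltsIfRejected d ⌝
... | inj₁ (halting , accepts) =
  let (v , halts) = haltsBefore-sound (haltsIfRejected d) _ (proj₂ halting) in
  contradiction (Eval-deterministic (halts⇒rejected d _ halts) accepts) (λ ())
... | inj₂ (¬halting , rejects) = ¬halting (haltsBefore-complete (haltsIfRejected d) (rejected⇒halts d _ rejects))

Iterate : (ℕ → ℕ) → ℕ → ℕ → Set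
Iterate f x y = ∃ λ c → iter f c x ≡ y

module _ (f h : ℕ → ℕ) (h∘f : ∀ x → h (f x) ≡ x) where

  iter-cancel : ∀ a x → iter h a (iter f a x) ≡ x
  iter-cancel zero    x = refl
  iter-cancel (suc a) x = begin
    iter h (suc a) (f (iter f a x)) ≡⟨ iter-suc h a _ ⟩
    iter h a (h (f (iter f a x)))   ≡⟨ cong (iter h a) (h∘f _) ⟩
    iter h a (iter f a x)           ≡⟨ iter-cancel a x ⟩
    x                               ∎
    where open ≡-Reasoning

  iterates-same : ∀ {z x y} → Iterate f z x → Iterate f z y → Iterate f x y ⊎ Iterate h x y
  iterates-same {z} (a , refl) (b , refl) with ≤-total a b
  ... | inj₁ a≤b = inj₁ (b ∸ a , trans (sym (iter-+ f (b ∸ a) a z)) (cong (λ c → iter f c z) (m∸n+n≡m a≤b)))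
  ... | inj₂ b≤a = inj₂ (a ∸ b , trans (cong (iter h (a ∸ b)) f-iterate) (iter-cancel (a ∸ b) _))
    where
    f-iterate : iter f a z ≡ iter f (a ∸ b) (iter f b z)
    f-iterate = trans (cong (λ c → iter f c z) (sym (m∸n+n≡m b≤a))) (iter-+ f (a ∸ b) b z)

  iterates-opposite : ∀ {z x y} → Iterate f z x → Iterate h z y → Iterate h x y
  iterates-opposite {z} (a , refl) (b , refl) =
    b + a , trans (iter-+ h b a _) (cong (iter h b) (iter-cancel a z))

module _ (g : Perm) where

  open Inverse g using (strictlyInverseˡ; strictlyInverseʳ) renaming (to to f; from to f⁻¹)

  CycleRel⇒Iterate : ∀ {x y} → CycleRel g x y → Iterate f x y ⊎ Iterate f⁻¹ x y
  CycleRel⇒Iterate (+ a , p)     = inj₁ (a , p)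
  CycleRel⇒Iterate (-[1+ a ] , p) = inj₂ (suc a , p)

  Iterate⇒CycleRel : ∀ {x y} → Iterate f x y ⊎ Iterate f⁻¹ x y → CycleRel g x y
  Iterate⇒CycleRel (inj₁ (a , p))       = + a , p
  Iterate⇒CycleRel (inj₂ (zero , p))    = + 0 , p
  Iterate⇒CycleRel (inj₂ (suc a , p))   = -[1+ a ] , p

  CycleRel-euclidean : ∀ {z x y} → CycleRel g z x → CycleRel g z y → CycleRel g x y
  CycleRel-euclidean zx zy with CycleRel⇒Iterate zx | CycleRel⇒Iterate zy
  ... | inj₁ p | inj₁ q = Iterate⇒CycleRel (iterates-same f f⁻¹ strictlyInverseʳ p q)
  ... | inj₁ p | inj₂ q = Iterate⇒CycleRel (inj₂ (iterates-opposite f f⁻¹ strictlyInverseʳ p q))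
  ... | inj₂ p | inj₁ q = Iterate⇒CycleRel (inj₁ (iterates-opposite f⁻¹ f strictlyInverseˡ p q))
  ... | inj₂ p | inj₂ q = Iterate⇒CycleRel (swap (iterates-same f⁻¹ f strictlyInverseˡ p q))

iter-preserves : ∀ {P : ℕ → Set} {f : ℕ → ℕ} → (∀ {x} → P x → P (f x)) → ∀ a {x} → P x → P (iter f a x)
iter-preserves P-f zero    p = p
iter-preserves {P} P-f (suc a) p = P-f (iter-preserves {P} P-f a p)

module _ (g : Perm) {P : ℕ → Set}
         (P-to : ∀ {x} → P x → P (Inverse.to g x)) (P-from : ∀ {x} → P x → P (Inverse.from g x)) where

  CycleRel-preserves : ∀ {x y} → CycleRel g x y → P x → P y
  CycleRel-preserves (+ a , refl)      = iter-preserves {P = P} P-to a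
  CycleRel-preserves (-[1+ a ] , refl) = iter-preserves {P = P} P-from (suc a)

fibrewise : (ℕ → ℕ → ℕ) → ℕ → ℕ
fibrewise F x = ⟨ π₁ x , F (π₁ x) (π₂ x) ⟩

fibrewise-⟨⟩ : ∀ F e n → fibrewise F ⟨ e , n ⟩ ≡ ⟨ e , F e n ⟩
fibrewise-⟨⟩ F e n = cong₂ (λ a b → ⟨ a , F a b ⟩) (π₁-⟨⟩ e n) (π₂-⟨⟩ e n)

iter-fibrewise : ∀ F a e n → iter (fibrewise F) a ⟨ e , n ⟩ ≡ ⟨ e , iter (F e) a n ⟩
iter-fibrewise F zero    e n = refl
iter-fibrewise F (suc a) e n = trans (cong (fibrewise F) (iter-fibrewise F a e n)) (fibrewise-⟨⟩ F e _)

fibrewise-inverse : ∀ G F → (∀ e n → G e (F e n) ≡ n) → ∀ x → fibrewise G (fibrewise F x) ≡ x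
fibrewise-inverse G F G∘F x = trans (fibrewise-⟨⟩ G (π₁ x) _) (trans (cong ⟨ π₁ x ,_⟩ (G∘F _ _)) (⟨π₁,π₂⟩ x))

Σ-Perm : (ℕ → Perm) → Perm
Σ-Perm σ = mk↔ₛ′ (fibrewise (Inverse.to ∘ σ)) (fibrewise (Inverse.from ∘ σ))
  (fibrewise-inverse (Inverse.to ∘ σ) (Inverse.from ∘ σ) (Inverse.strictlyInverseˡ ∘ σ))
  (fibrewise-inverse (Inverse.from ∘ σ) (Inverse.to ∘ σ) (Inverse.strictlyInverseʳ ∘ σ))

module _ (σ : ℕ → Perm) where

  pow-Σ-Perm : ∀ k e n → pow (Σ-Perm σ) k ⟨ e , n ⟩ ≡ ⟨ e , pow (σ e) k n ⟩
  pow-Σ-Perm (+ a)      = iter-fibrewise (Inverse.to ∘ σ) a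
  pow-Σ-Perm (-[1+ a ]) = iter-fibrewise (Inverse.from ∘ σ) (suc a)

  CycleRel-Σ-Perm : ∀ x y → CycleRel (Σ-Perm σ) x y ⇔ (π₁ y ≡ π₁ x × CycleRel (σ (π₁ x)) (π₂ x) (π₂ y))
  CycleRel-Σ-Perm x y =
    subst (λ z → CycleRel (Σ-Perm σ) z y ⇔ (π₁ y ≡ π₁ x × CycleRel (σ (π₁ x)) (π₂ x) (π₂ y))) (⟨π₁,π₂⟩ x) (mk⇔
      (λ { (k , refl) → trans (cong π₁ (pow-Σ-Perm k _ _)) (π₁-⟨⟩ (π₁ x) _)
                      , k , sym (trans (cong π₂ (pow-Σ-Perm k _ _)) (π₂-⟨⟩ (π₁ x) _)) })
      (λ { (π₁y≡π₁x , k , p) → k , trans (pow-Σ-Perm k _ _) (trans (cong₂ ⟨_,_⟩ (sym π₁y≡π₁x) p) (⟨π₁,π₂⟩ y)) }))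

  CycleFinite-Σ-Perm : ∀ e n → CycleFinite (Σ-Perm σ) ⟨ e , n ⟩ ⇔ CycleFinite (σ e) n
  CycleFinite-Σ-Perm e n = mk⇔
    (λ (l , orbit⊆l) → map π₂ l , λ k →
      subst (_∈ map π₂ l) (trans (cong π₂ (pow-Σ-Perm k e n)) (π₂-⟨⟩ e _)) (∈-map⁺ π₂ (orbit⊆l k)))
    (λ (l , orbit⊆l) → map ⟨ e ,_⟩ l , λ k →
      subst (_∈ map ⟨ e ,_⟩ l) (sym (pow-Σ-Perm k e n)) (∈-map⁺ ⟨ e ,_⟩ (orbit⊆l k)))

double : ℕ → ℕ
double zero    = zero
double (suc k) = suc (suc (double k))

-- The points of a column form the chain ⋯ → left 1 → left 0 → right 0 → right 1 → ⋯,
-- coded by right k ↦ 2k and left k ↦ 2k + 1.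
data Point : Set where
  right : ℕ → Point
  left  : ℕ → Point

encode : Point → ℕ
encode (right k) = double k
encode (left k)  = suc (double k)

index : Point → ℕ
index (right k) = k
index (left k)  = k

next : Point → Point
next (right k) = left k
next (left k)  = right (suc k)

opaque

  isOdd : ℕ → Bool
  isOdd = natrec false (λ _ → not)

  half : ℕ → ℕ
  half = natrec 0 (λ n h → if isOdd n then suc h else h)

  isOdd-double : ∀ k → isOdd (double k) ≡ false
  isOdd-double zero    = refl
  isOdd-double (suc k) = cong (not ∘ not) (isOdd-double k)

  half-double : ∀ k → half (double k) ≡ k
  half-double zero    = refl
  half-double (suc k) rewrite isOdd-double k | half-double k = refl

  isOdd-suc-double : ∀ k → isOdd (suc (double k)) ≡ true
  isOdd-suc-double k = cong not (isOdd-double k)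

  half-suc-double : ∀ k → half (suc (double k)) ≡ k
  half-suc-double k rewrite isOdd-double k = half-double k

  isOdd-computable : Computable 1 (λ n → fromBool (isOdd n))
  isOdd-computable = fromV-≗ (λ { (n ∷ []) → natrec-isOdd n }) (natrecᶜ (constᶜ 0) (∸-computable $ᶜ constᶜ 1 ∷ x₁ ∷ []))
    where
    natrec-isOdd : ∀ n → natrec 0 (λ _ r → 1 ∸ r) n ≡ fromBool (isOdd n)
    natrec-isOdd zero    = refl
    natrec-isOdd (suc n) rewrite natrec-isOdd n with isOdd n
    ... | true  = refl
    ... | false = refl

  half-computable : Computable 1 half
  half-computable = fromV (natrecᶜ (constᶜ 0) (ifᶜ (isOdd-computable $ᶜ x₀ ∷ []) (sucᶜ x₁) x₁))

  decode : ℕ → Point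
  decode n = if isOdd n then left (half n) else right (half n)

  decode-encode : ∀ p → decode (encode p) ≡ p
  decode-encode (right k) = cong₂ (λ b h → if b then left h else right h) (isOdd-double k) (half-double k)
  decode-encode (left k)  = cong₂ (λ b h → if b then left h else right h) (cong not (isOdd-double k)) (half-suc-double k)

  half-encode : ∀ p → half (encode p) ≡ index p
  half-encode (right k) = half-double k
  half-encode (left k)  = half-suc-double k

  decode-suc : ∀ n → decode (suc n) ≡ next (decode n)
  decode-suc n with isOdd n
  ... | true  = refl
  ... | false = refl

  index-decode : ∀ n → index (decode n) ≡ half n
  index-decode n with isOdd n
  ... | true  = refl
  ... | false = refl

  encode-decode : ∀ n → encode (decode n) ≡ n
  encode-decode zero    = refl
  encode-decode (suc n) = trans (cong encode (decode-suc n)) (trans (encode-next (decode n)) (cong suc (encode-decode n)))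
    where
    encode-next : ∀ p → encode (next p) ≡ suc (encode p)
    encode-next (right k) = refl
    encode-next (left k)  = refl

double-mono : ∀ {k k′} → k ≤ k′ → double k ≤ double k′
double-mono z≤n       = z≤n
double-mono (s≤s k≤k′) = s≤s (s≤s (double-mono k≤k′))

n≤double : ∀ n → n ≤ double n
n≤double zero    = z≤n
n≤double (suc n) = s≤s (m≤n⇒m≤1+n (n≤double n))

≤-suc-double-half : ∀ n → n ≤ suc (double (half n))
≤-suc-double-half n = subst₂ (λ m k → m ≤ suc (double k)) (encode-decode n) (index-decode n) (encode≤ (decode n))
  where
  encode≤ : ∀ p → encode p ≤ suc (double (index p))
  encode≤ (right k) = n≤1+n _
  encode≤ (left k)  = ≤-refl

conjugate : (Point → Point) → ℕ → ℕ
conjugate f = encode ∘ f ∘ decode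

conjugate-inverse : ∀ {f g} → (∀ p → f (g p) ≡ p) → ∀ n → conjugate f (conjugate g n) ≡ n
conjugate-inverse {f} {g} f∘g n = begin
  encode (f (decode (encode (g (decode n))))) ≡⟨ cong (encode ∘ f) (decode-encode (g (decode n))) ⟩
  encode (f (g (decode n)))                   ≡⟨ cong encode (f∘g (decode n)) ⟩
  encode (decode n)                           ≡⟨ encode-decode n ⟩
  n                                           ∎
  where open ≡-Reasoning

conjugate-encode : ∀ f p → conjugate f (encode p) ≡ encode (f p)
conjugate-encode f p = cong (encode ∘ f) (decode-encode p)

-- conjugate shift as a closed formula; pred (pred n) covers left 0 ↦ right 0 as well.
stepFormula : (ℕ → Bool) → ℕ → ℕ
stepFormula H n = if isOdd n then (if H (half n) then n else pred (pred n))
                  else (if H (half n) then n else if H (suc (half n)) then suc n else suc (suc n))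

stepFormula-computable : {H : ℕ → ℕ → Bool} → Computable 2 (λ e k → fromBool (H e k)) →
                         Computable 2 (λ e n → stepFormula (H e) n)
stepFormula-computable cH = fromV
  (ifᶜ (isOdd-computable $ᶜ x₁ ∷ [])
    (ifᶜ (cH $ᶜ x₀ ∷ half₁ ∷ []) x₁ (pred-computable $ᶜ (pred-computable $ᶜ x₁ ∷ []) ∷ []))
    (ifᶜ (cH $ᶜ x₀ ∷ half₁ ∷ []) x₁ (ifᶜ (cH $ᶜ x₀ ∷ sucᶜ half₁ ∷ []) (sucᶜ x₁) (sucᶜ (sucᶜ x₁)))))
  where
  half₁ : ComputableV 2 (λ xs → half (lookup xs (# 1)))
  half₁ = half-computable $ᶜ x₁ ∷ []

columnRel : (ℕ → Bool) → ℕ → ℕ → Bool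
columnRel H n m = (n ≡ᵇ m) ∨ (not (H (half n)) ∧ not (H (half m)))

columnRel-computable : {H : ℕ → ℕ → Bool} → Computable 2 (λ e k → fromBool (H e k)) →
                       Computable 3 (λ e n m → fromBool (columnRel (H e) n m))
columnRel-computable cH = fromV (∨ᶜ (≡ᵇᶜ x₁ x₂)
  (∧ᶜ (notᶜ (cH $ᶜ x₀ ∷ (half-computable $ᶜ x₁ ∷ []) ∷ [])) (notᶜ (cH $ᶜ x₀ ∷ (half-computable $ᶜ x₂ ∷ []) ∷ []))))

-- H k means that the computation has halted before stage k. If H first holds at stage s, shift
-- sends right (s ∸ 1) to left (s ∸ 1), closing the cycle of right 0, and fixes every point of
-- index at least s.
module ColumnPermutation (H : ℕ → Bool) (H-mono : ∀ {k} → T (H k) → T (H (suc k))) where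

  shift : Point → Point
  shift (right k)      = if H k then right k else if H (suc k) then left k else right (suc k)
  shift (left zero)    = if H 0 then left 0 else right 0
  shift (left (suc k)) = if H (suc k) then left (suc k) else left k

  unshift : Point → Point
  unshift (right zero)    = if H 0 then right 0 else left 0
  unshift (right (suc k)) = if H (suc k) then right (suc k) else right k
  unshift (left k)        = if H k then left k else if H (suc k) then right k else left (suc k)

  dead-suc : ∀ {k} → H k ≡ true → H (suc k) ≡ true
  dead-suc {k} dead = T-≡ .to (H-mono (T-≡ .from dead))

  live-pred : ∀ {k} → H (suc k) ≡ false → H k ≡ false
  live-pred {k} live with H k in dead
  ... | false = refl
  ... | true  = contradiction (trans (sym (dead-suc dead)) live) λ ()

  unshift-shift : ∀ p → unshift (shift p) ≡ p
  unshift-shift (right k) with H k in dead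
  unshift-shift (right zero)    | true rewrite dead = refl
  unshift-shift (right (suc k)) | true rewrite dead = refl
  ... | false with H (suc k) in last
  ...   | true  rewrite dead | last = refl
  ...   | false rewrite last = refl
  unshift-shift (left zero) with H 0 in dead
  ... | true  rewrite dead = refl
  ... | false rewrite dead = refl
  unshift-shift (left (suc k)) with H (suc k) in dead
  ... | true  rewrite dead = refl
  ... | false rewrite live-pred dead | dead = refl

  shift-unshift : ∀ p → shift (unshift p) ≡ p
  shift-unshift (right zero) with H 0 in dead
  ... | true  rewrite dead = refl
  ... | false rewrite dead = refl
  shift-unshift (right (suc k)) with H (suc k) in dead
  ... | true  rewrite dead = refl
  ... | false rewrite live-pred dead | dead = refl
  shift-unshift (left k) with H k in dead
  shift-unshift (left zero)    | true rewrite dead = refl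
  shift-unshift (left (suc k)) | true rewrite dead = refl
  ... | false with H (suc k) in last
  ...   | true  rewrite dead | last = refl
  ...   | false rewrite last = refl

  columnPerm : Perm
  columnPerm = mk↔ₛ′ (conjugate shift) (conjugate unshift)
    (conjugate-inverse {shift} {unshift} shift-unshift) (conjugate-inverse {unshift} {shift} unshift-shift)

  Live : ℕ → Set
  Live n = H (half n) ≡ false

  shift-dead : ∀ p → H (index p) ≡ true → shift p ≡ p
  shift-dead (right k)      dead rewrite dead = refl
  shift-dead (left zero)    dead rewrite dead = refl
  shift-dead (left (suc k)) dead rewrite dead = refl

  unshift-dead : ∀ p → H (index p) ≡ true → unshift p ≡ p
  unshift-dead (right zero)    dead rewrite dead = refl
  unshift-dead (right (suc k)) dead rewrite dead = refl
  unshift-dead (left k)        dead rewrite dead = refl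

  shift-live : ∀ p → H (index p) ≡ false → H (index (shift p)) ≡ false
  shift-live (right k) live rewrite live with H (suc k) in last
  ... | true  = live
  ... | false = last
  shift-live (left zero)    live rewrite live = live
  shift-live (left (suc k)) live rewrite live = live-pred live

  unshift-live : ∀ p → H (index p) ≡ false → H (index (unshift p)) ≡ false
  unshift-live (right zero)    live rewrite live = live
  unshift-live (right (suc k)) live rewrite live = live-pred live
  unshift-live (left k) live rewrite live with H (suc k) in last
  ... | true  = live
  ... | false = last

  conjugate-dead : ∀ f → (∀ p → H (index p) ≡ true → f p ≡ p) → ∀ n → H (half n) ≡ true → conjugate f n ≡ n
  conjugate-dead f f-dead n dead =
    trans (cong encode (f-dead (decode n) (trans (cong H (index-decode n)) dead))) (encode-decode n)

  conjugate-live : ∀ f → (∀ p → H (index p) ≡ false → H (index (f p)) ≡ false) → ∀ {n} → Live n → Live (conjugate f n)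
  conjugate-live f f-live {n} live = begin
    H (half (encode (f (decode n)))) ≡⟨ cong H (half-encode (f (decode n))) ⟩
    H (index (f (decode n)))         ≡⟨ f-live (decode n) (trans (cong H (index-decode n)) live) ⟩
    false                            ∎
    where open ≡-Reasoning

  forward : ∀ k → H k ≡ false → iter (conjugate shift) k 0 ≡ double k
  forward zero    _    = refl
  forward (suc k) live = begin
    conjugate shift (iter (conjugate shift) k 0) ≡⟨ cong (conjugate shift) (forward k (live-pred live)) ⟩
    conjugate shift (encode (right k))           ≡⟨ conjugate-encode shift (right k) ⟩
    encode (shift (right k))                     ≡⟨ cong encode (shift-right (live-pred live) live) ⟩
    double (suc k)                               ∎
    where
    open ≡-Reasoning
    shift-right : H k ≡ false → H (suc k) ≡ false → shift (right k) ≡ right (suc k)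
    shift-right live live′ rewrite live | live′ = refl

  backward : ∀ k → H k ≡ false → iter (conjugate unshift) (suc k) 0 ≡ suc (double k)
  backward zero    live rewrite conjugate-encode unshift (right 0) | live = refl
  backward (suc k) live = begin
    conjugate unshift (iter (conjugate unshift) (suc k) 0) ≡⟨ cong (conjugate unshift) (backward k (live-pred live)) ⟩
    conjugate unshift (encode (left k))                    ≡⟨ conjugate-encode unshift (left k) ⟩
    encode (unshift (left k))                              ≡⟨ cong encode (unshift-left (live-pred live) live) ⟩
    suc (double (suc k))                                   ∎
    where
    open ≡-Reasoning
    unshift-left : H k ≡ false → H (suc k) ≡ false → unshift (left k) ≡ left (suc k)
    unshift-left live live′ rewrite live | live′ = refl

  liveOrDead : ∀ n → Live n ⊎ H (half n) ≡ true
  liveOrDead n with H (half n)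
  ... | false = inj₁ refl
  ... | true  = inj₂ refl

  reachable : ∀ p → H (index p) ≡ false → CycleRel columnPerm 0 (encode p)
  reachable (right k) live = + k , forward k live
  reachable (left k)  live = -[1+ k ] , backward k live

  Live⇒reachable : ∀ {n} → Live n → CycleRel columnPerm 0 n
  Live⇒reachable {n} live =
    subst (CycleRel columnPerm 0) (encode-decode n) (reachable (decode n) (trans (cong H (index-decode n)) live))

  CycleRel-column : ∀ n m → CycleRel columnPerm n m ⇔ (n ≡ m ⊎ (Live n × Live m))
  CycleRel-column n m = mk⇔ classify connect
    where
    connect : n ≡ m ⊎ (Live n × Live m) → CycleRel columnPerm n m
    connect (inj₁ refl)           = + 0 , refl
    connect (inj₂ (live , live′)) = CycleRel-euclidean columnPerm (Live⇒reachable live) (Live⇒reachable live′)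

    classify : CycleRel columnPerm n m → n ≡ m ⊎ (Live n × Live m)
    classify nm with liveOrDead n
    ... | inj₁ live = inj₂ (live , CycleRel-preserves columnPerm {P = Live}
                                     (conjugate-live shift shift-live) (conjugate-live unshift unshift-live) nm live)
    ... | inj₂ dead = inj₁ (sym (CycleRel-preserves columnPerm {P = _≡ n}
                                  (λ { refl → conjugate-dead shift shift-dead n dead })
                                  (λ { refl → conjugate-dead unshift unshift-dead n dead }) nm refl))

  H-mono≤ : ∀ {k k′} → k ≤ k′ → T (H k) → T (H k′)
  H-mono≤ {k′ = k′} k≤k′ h with m≤n⇒m<n∨m≡n k≤k′
  ... | inj₂ refl = h
  H-mono≤ {k′ = suc k′} _ h | inj₁ k<1+k′ = H-mono (H-mono≤ (≤-pred k<1+k′) h)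

  Live⇒< : ∀ {s n} → T (H s) → Live n → n < double s
  Live⇒< {s} {n} halted live = begin-strict
    n                     ≤⟨ ≤-suc-double-half n ⟩
    suc (double (half n)) <⟨ n<1+n _ ⟩
    double (suc (half n)) ≤⟨ double-mono half<s ⟩
    double s              ∎
    where
    open ≤-Reasoning
    half<s : half n < s
    half<s = ≰⇒> λ s≤half → subst T live (H-mono≤ s≤half halted)

  CycleFinite-column : CycleFinite columnPerm 0 ⇔ ∃ λ s → T (H s)
  CycleFinite-column = mk⇔ halting bounded
    where
    bounded : ∃ (T ∘ H) → CycleFinite columnPerm 0
    bounded (s , halted) = upTo (suc (double s)) , λ k → ∈-upTo⁺ (inBounds (CycleRel-column 0 _ .to (k , refl)))
      where
      inBounds : ∀ {n} → 0 ≡ n ⊎ (Live 0 × Live n) → n < suc (double s)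
      inBounds (inj₁ refl)        = s≤s z≤n
      inBounds (inj₂ (_ , live)) = m<n⇒m<1+n (Live⇒< halted live)

    -- Unless H holds at 1 + max l, the iterate right (1 + max l) of right 0 exceeds every element of l.
    halting : CycleFinite columnPerm 0 → ∃ (T ∘ H)
    halting (l , orbit⊆l) with H (suc (max 0 l)) in h
    ... | true  = suc (max 0 l) , subst T (sym h) _
    ... | false =
      contradiction (All.lookup (xs≤max 0 l) double∈l) (<⇒≱ (<-≤-trans (n<1+n _) (n≤double (suc (max 0 l)))))
      where
      double∈l : double (suc (max 0 l)) ∈ l
      double∈l = subst (_∈ l) (forward (suc (max 0 l)) h) (orbit⊆l (+ suc (max 0 l)))

  shift-formula : ∀ p → encode (shift p) ≡ stepFormula H (encode p)
  shift-formula (right k) rewrite isOdd-double k | half-double k with H k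
  ... | true  = refl
  ... | false with H (suc k)
  ...   | true  = refl
  ...   | false = refl
  shift-formula (left zero) rewrite isOdd-suc-double 0 | half-suc-double 0 with H 0
  ... | true  = refl
  ... | false = refl
  shift-formula (left (suc k)) rewrite isOdd-suc-double (suc k) | half-suc-double (suc k) with H (suc k)
  ... | true  = refl
  ... | false = refl

  columnPerm-formula : ∀ n → Inverse.to columnPerm n ≡ stepFormula H n
  columnPerm-formula n = trans (shift-formula (decode n)) (cong (stepFormula H) (encode-decode n))

  T-columnRel : ∀ n m → T (columnRel H n m) ⇔ CycleRel columnPerm n m
  T-columnRel n m = mk⇔
    (CycleRel-column n m .from ∘ Sum.map (≡ᵇ⇒≡ n m) (Product.map (T-not-≡ .to) (T-not-≡ .to) ∘ T-∧ .to) ∘ T-∨ .to)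
    (T-∨ .from ∘ Sum.map (≡⇒≡ᵇ n m) (T-∧ .from ∘ Product.map (T-not-≡ .from) (T-not-≡ .from)) ∘ CycleRel-column n m .to)

module HaltingColumn (e : ℕ) = ColumnPermutation (haltsBefore e) (haltsBefore-mono e (n≤1+n _))

halting-cycles : Perm
halting-cycles = Σ-Perm HaltingColumn.columnPerm

halting-cycles-recursive : Recursive (Inverse.to halting-cycles)
halting-cycles-recursive = Computable⇒Recursive (fromV-≗
  (λ { (x ∷ []) → cong ⟨ π₁ x ,_⟩ (sym (HaltingColumn.columnPerm-formula (π₁ x) (π₂ x))) })
  (⟨⟩-computable $ᶜ e ∷ (stepFormula-computable haltsBefore-computable $ᶜ e ∷ (π₂-computable $ᶜ x₀ ∷ []) ∷ []) ∷ []))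
  where
  e : ComputableV 1 (λ xs → π₁ (lookup xs (# 0)))
  e = π₁-computable $ᶜ x₀ ∷ []

cycleRel : ℕ → ℕ → Bool
cycleRel x y = (π₁ y ≡ᵇ π₁ x) ∧ columnRel (haltsBefore (π₁ x)) (π₂ x) (π₂ y)

cycleRel-computable : Computable 2 (λ x y → fromBool (cycleRel x y))
cycleRel-computable = fromV (∧ᶜ (≡ᵇᶜ (π₁-computable $ᶜ x₁ ∷ []) (π₁-computable $ᶜ x₀ ∷ []))
  (columnRel-computable haltsBefore-computable
     $ᶜ (π₁-computable $ᶜ x₀ ∷ []) ∷ (π₂-computable $ᶜ x₀ ∷ []) ∷ (π₂-computable $ᶜ x₁ ∷ []) ∷ []))

T-cycleRel : ∀ x y → T (cycleRel x y) ⇔ CycleRel halting-cycles x y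
T-cycleRel x y = mk⇔
  (CycleRel-Σ-Perm HaltingColumn.columnPerm x y .from ∘ Product.map (≡ᵇ⇒≡ _ _) (T-columnRel′ .to) ∘ T-∧ .to)
  (T-∧ .from ∘ Product.map (≡⇒≡ᵇ _ _) (T-columnRel′ .from) ∘ CycleRel-Σ-Perm HaltingColumn.columnPerm x y .to)
  where
  T-columnRel′ : T (columnRel (haltsBefore (π₁ x)) (π₂ x) (π₂ y))
               ⇔ CycleRel (HaltingColumn.columnPerm (π₁ x)) (π₂ x) (π₂ y)
  T-columnRel′ = HaltingColumn.T-columnRel (π₁ x) (π₂ x) (π₂ y)

CycleFinite-halting-cycles : ∀ e → CycleFinite halting-cycles ⟨ e , 0 ⟩ ⇔ SelfHalting e
CycleFinite-halting-cycles e = mk⇔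
  (HaltingColumn.CycleFinite-column e .to ∘ CycleFinite-Σ-Perm HaltingColumn.columnPerm e 0 .to)
  (CycleFinite-Σ-Perm HaltingColumn.columnPerm e 0 .from ∘ HaltingColumn.CycleFinite-column e .from)

lemma4p2 : Σ Perm λ g →
    Recursive (Inverse.to g) × RecDecidable₂ (CycleRel g) × ¬ RecDecidable (CycleFinite g)
lemma4p2 = halting-cycles
         , halting-cycles-recursive
         , RecDecidable₂-reflects cycleRel-computable T-cycleRel
         , SelfHalting-undecidable ∘ RecDecidable-⇔ CycleFinite-halting-cycles ∘ RecDecidable-∘ pair-with-0
  where
  pair-with-0 : Computable 1 ⟨_, 0 ⟩
  pair-with-0 = fromV (⟨⟩-computable $ᶜ x₀ ∷ constᶜ 0 ∷ [])
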